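{- Let $G$ be a finite graph (undirected; multiple edges and loops allowed) with $n(G)$ vertices and $m(G)$ edges. Then for every integer $k\ge 2$, $$C(G,k)=\frac{(k-1)^{m(G)}}{k^{m(G)-n(G)}}\sum_{H\le G}\frac{F(H,k)}{(1-k)^{m(H)}},$$ where the sum runs over all edge subgraphs $H$ of $G$ (including the empty one).
   Context: Graphs are finite and undirected, and may have multiple edges and loops; $n(H)$ and $m(H)$ denote the number of vertices and edges of $H$. $H\le G$ means $H$ is an edge subgraph of $G$: $E(H)\subseteq E(G)$ and $V(H)$ consists exactly of the vertices of $G$ incident to edges of $E(H)$; the case $E(H)=V(H)=\emptyset$ is allowed, and distinct edge sets give distinct terms in the sum. $C(H,k)$ is the chromatic polynomial: the number of maps $s:V(H)\to\mathbb{Z}/k\mathbb{Z}$ such that the two ends of every edge receive different values (so $C(H,k)=0$ if $H$ has a loop). $F(H,k)$ is the flow polynomial: fix an orientation of every edge $e$, with tail $e'$ and head $e''$; $F(H,k)$ is the number of maps $t:E(H)\to\mathbb{Z}/k\mathbb{Z}$ with $t(e)\neq 0$ for all $e$ and $\sum_{e:\,e'=v}t(e)=\sum_{e:\,e''=v}t(e)$ in $\mathbb{Z}/k\mathbb{Z}$ for every vertex $v$ (a loop at $v$ contributes to both sides); this number does not depend on the chosen orientation. For the empty graph, $F=1$. -}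

module Defs where

open import Data.Nat as ℕ using (ℕ; zero; suc)
open import Data.Nat.Divisibility using (_∣?_)
open import Data.Integer as ℤ using (ℤ; +_)
open import Data.Integer.Divisibility using (_∣_)
open import Data.Fin using (Fin; toℕ; _≟_)
open import Data.Fin.Properties using () renaming (_≟_ to _≟F_)
open import Data.Vec.Functional using () renaming (_∷_ to _∷ᶠ_)
open import Data.List using (List; []; _∷_; _++_; map; concatMap; length; filter; lookup; allFin; foldr)
open import Data.List.Relation.Unary.All using (All)
open import Data.List.Relation.Unary.All as All using ()
open import Data.Product using (_×_; _,_; proj₁; proj₂)
open import Data.Bool using (Bool; true; false; if_then_else_)
open import Relation.Nullary using (¬_; Dec; yes; no)
open import Relation.Nullary.Decidable using (¬?; ⌊_⌋)
open import Relation.Unary using (Decidable)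
open import Relation.Binary.PropositionalEquality using (_≡_; _≢_)
open import Data.Rational as ℚ using (ℚ; 0ℚ; 1ℚ; _*_; _+_; _-_; _÷_)
import Data.Rational.Properties as ℚP

-- Vertices are Fin n; edges are given as a list of (tail , head) pairs,
-- i.e. each edge comes with a fixed orientation; distinct list positions
-- are distinct edges.

record Graph : Set where
  field
    n     : ℕ
    edges : List (Fin n × Fin n)

open Graph public

nV : Graph → ℕ
nV G = n G

mE : Graph → ℕ
mE G = length (edges G)

allFuns : ∀ {A : Set} → List A → (d : ℕ) → List (Fin d → A)
allFuns xs zero    = (λ ()) ∷ []
allFuns xs (suc d) = concatMap (λ a → map (λ f → a ∷ᶠ f) (allFuns xs d)) xs

count : ∀ {A : Set} {P : A → Set} → Decidable P → List A → ℕ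
count P? xs = length (filter P? xs)

Proper : (G : Graph) (k : ℕ) → (Fin (n G) → Fin k) → Set
Proper G k s = All (λ e → s (proj₁ e) ≢ s (proj₂ e)) (edges G)

proper? : (G : Graph) (k : ℕ) → Decidable (Proper G k)
proper? G k s = All.all? (λ e → ¬? (s (proj₁ e) ≟F s (proj₂ e))) (edges G)

chromatic : Graph → ℕ → ℕ
chromatic G k = count (proper? G k) (allFuns (allFin k) (n G))

-- Flow polynomial F(H,k): number of maps t : E(H) → ℤ/kℤ (= Fin k,
-- value read off via toℕ), nowhere zero, with Kirchhoff's law modulo k at
-- every vertex: sum over edges with tail v = sum over edges with head v.

endSum : ∀ {N k} (es : List (Fin N × Fin N)) → (Fin N × Fin N → Fin N) →
         (Fin (length es) → Fin k) → Fin N → ℕ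
endSum es end t v =
  foldr ℕ._+_ 0 (map (λ i → if ⌊ end (lookup es i) ≟F v ⌋ then toℕ (t i) else 0)
                     (allFin (length es)))

IsNZFlow : (H : Graph) (k : ℕ) → (Fin (mE H) → Fin k) → Set
IsNZFlow H k t =
  All (λ i → toℕ (t i) ≢ 0) (allFin (mE H)) ×
  All (λ v → (+ k) ∣ (+ endSum (edges H) proj₁ t v ℤ.- + endSum (edges H) proj₂ t v))
      (allFin (n H))

isNZFlow? : (H : Graph) (k : ℕ) → Decidable (IsNZFlow H k)
isNZFlow? H k t with All.all? (λ i → ¬? (toℕ (t i) ℕ.≟ 0)) (allFin (mE H))
                   | All.all? (λ v → k ∣? ℤ.∣ + endSum (edges H) proj₁ t v ℤ.- + endSum (edges H) proj₂ t v ∣)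
                              (allFin (n H))
... | yes a | yes b = yes (a , b)
... | no ¬a | _     = no (λ p → ¬a (proj₁ p))
... | yes _ | no ¬b = no (λ p → ¬b (proj₂ p))

flow : Graph → ℕ → ℕ
flow H k = count (isNZFlow? H k) (allFuns (allFin k) (mE H))

-- Edge subgraphs: every choice of a subset of the edge positions
-- (each edge in or out), 2^m(G) choices, distinct edge sets listed
-- separately.

sublists : ∀ {A : Set} → List A → List (List A)
sublists []       = [] ∷ []
sublists (x ∷ xs) = map (x ∷_) (sublists xs) ++ sublists xs

-- H with edge list es; vertex set taken as V(G) (F(H,k) and
-- m(H) do not depend on additional isolated vertices).
edgeSubgraphs : Graph → List Graph
edgeSubgraphs G = map (λ es → record { n = n G ; edges = es }) (sublists (edges G))

ℕ→ℚ : ℕ → ℚ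
ℕ→ℚ m = (+ m) ℚ./ 1

_^ℚ_ : ℚ → ℕ → ℚ
p ^ℚ zero  = 1ℚ
p ^ℚ suc e = p * (p ^ℚ e)

-- total division (x / 0 := 0); only used with nonzero denominators
_/ℚ_ : ℚ → ℚ → ℚ
p /ℚ q with q ℚP.≟ 0ℚ
... | yes _ = 0ℚ
... | no q≢0 = _÷_ p q {{ℚ.≢-nonZero {q} q≢0}}

sumℚ : List ℚ → ℚ
sumℚ = foldr _+_ 0ℚ

-- Write ∑⊆[ α , β ] E f = ∑_{A ⊆ E} α^|A| β^|E∖A| f(A) for an edge list E.
-- The proof has three steps, each about edge lists on the vertex set Fin n.
--  1. Inclusion–exclusion: a colouring is proper iff it is constant on no
--     edge, so k^m C(G,k) = ∑⊆[ -1 , k ] E (A ↦ k^|A| · #{colourings constant on A}).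
--  2. Duality, by contracting the edges one at a time: for every edge list A,
--     k^|A| · #{colourings constant on A} = k^n · #{ℤ/k-flows on A}.
--  3. Every ℤ/k-flow is a nowhere-zero flow on its support. Following this
--     edge by edge, for flows with an arbitrary demand at each vertex, gives
--     ∑⊆[ -1 , k ] E (all flows) = ∑⊆[ -1 , k-1 ] E (nowhere-zero flows), and
--     ∑⊆[ -1 , k-1 ] E g = (k-1)^m ∑_{A ⊆ E} g(A) / (1-k)^|A|.

module Submission where

open import Defs
open import Function using (_∘_; id; const; _⇔_; mk⇔; Equivalence)
open import Data.Bool using (if_then_else_)
open import Data.Empty using (⊥-elim)
open import Data.Product using (_×_; _,_; proj₁; proj₂; ∃-syntax)
open import Data.Sum using (_⊎_; inj₁; inj₂)
open import Data.Nat as ℕ using (ℕ; zero; suc; _≤_; s≤s)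
import Data.Nat.Properties as ℕP
import Data.Nat.Divisibility as ℕD
open import Data.Integer as ℤ using (ℤ; +_; 0ℤ)
import Data.Integer.Properties as ℤP
open import Data.Integer.Divisibility.Signed using (_∣_; _∣?_; divides; ∣⇒∣ᵤ; ∣ᵤ⇒∣; ∣m∣n⇒∣m+n; ∣m∣n⇒∣m-n; ∣m⇒∣-m)
open import Data.Integer.DivMod using (_%ℕ_; _/ℕ_; n%ℕd<d; a≡a%ℕn+[a/ℕn]*n)
open import Data.Integer.Tactic.RingSolver using (solve-∀)
open import Data.Rational using (ℚ; 0ℚ; 1ℚ; _+_; _*_; _-_; -_; 1/_; NonZero; ≢-nonZero; toℚᵘ)
import Data.Rational.Properties as ℚP
import Data.Rational.Unnormalised as ℚᵘ
import Data.Rational.Unnormalised.Properties as ℚᵘP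
open import Data.Rational.Solver using (module +-*-Solver)
open import Data.Fin using (Fin; zero; suc; toℕ; fromℕ<)
import Data.Fin.Properties as FinP
open import Data.List using (List; []; _∷_; _++_; map; concatMap; foldr; allFin; length; lookup)
import Data.List.Properties as ListP
open import Data.List.Relation.Unary.All as All using (All; _∷_)
import Data.List.Relation.Unary.All.Properties as AllP
open import Data.Vec.Functional using (updateAt) renaming (_∷_ to _◂_)
open import Data.Vec.Functional.Properties using (updateAt-updates; updateAt-minimal)
open import Relation.Nullary using (Dec; yes; no; ¬_)
open import Relation.Nullary.Decidable using (_×-dec_; ¬?; ⌊_⌋)
open import Relation.Unary using (Decidable)
open import Relation.Binary.PropositionalEquality
  using (_≡_; _≢_; _≗_; refl; sym; trans; cong; cong₂; subst; module ≡-Reasoning)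

open +-*-Solver

private variable X Y : Set

ℕ→ℚ-suc : ∀ m → ℕ→ℚ (suc m) ≡ 1ℚ + ℕ→ℚ m
ℕ→ℚ-suc m = ℚP.toℚᵘ-injective (begin
    toℚᵘ (ℕ→ℚ (suc m))             ≈⟨ ℚP.toℚᵘ-fromℚᵘ (ℚᵘ.mkℚᵘ (+ (suc m)) 0) ⟩
    ℚᵘ.mkℚᵘ (+ (suc m)) 0             ≈⟨ ℚᵘ.*≡* numerators ⟩
    toℚᵘ 1ℚ ℚᵘ.+ ℚᵘ.mkℚᵘ (+ m) 0    ≈⟨ ℚᵘP.+-congʳ (toℚᵘ 1ℚ) (ℚᵘP.≃-sym (ℚP.toℚᵘ-fromℚᵘ (ℚᵘ.mkℚᵘ (+ m) 0))) ⟩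
    toℚᵘ 1ℚ ℚᵘ.+ toℚᵘ (ℕ→ℚ m)       ≈⟨ ℚᵘP.≃-sym (ℚP.toℚᵘ-homo-+ 1ℚ (ℕ→ℚ m)) ⟩
    toℚᵘ (1ℚ + ℕ→ℚ m)               ∎)
  where
  open ℚᵘP.≃-Reasoning
  numerators : + (suc m) ℤ.* + 1 ≡ (+ 1 ℤ.+ + m ℤ.* + 1) ℤ.* + 1
  numerators = cong (λ z → z ℤ.* + 1) (cong (λ z → + 1 ℤ.+ z) (sym (ℤP.*-identityʳ (+ m))))

ℕ→ℚ-injective : ∀ {a b} → ℕ→ℚ a ≡ ℕ→ℚ b → a ≡ b
ℕ→ℚ-injective {a} {b} eq
  with ℚᵘP.≃-trans (ℚᵘP.≃-sym (ℚP.toℚᵘ-fromℚᵘ (ℚᵘ.mkℚᵘ (+ a) 0)))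
         (ℚᵘP.≃-trans (ℚᵘP.≃-reflexive (cong toℚᵘ eq)) (ℚP.toℚᵘ-fromℚᵘ (ℚᵘ.mkℚᵘ (+ b) 0)))
... | ℚᵘ.*≡* e = ℤP.+-injective (trans (sym (ℤP.*-identityʳ (+ a))) (trans e (ℤP.*-identityʳ (+ b))))

ℕ→ℚ-suc≢0 : ∀ m → ℕ→ℚ (suc m) ≢ 0ℚ
ℕ→ℚ-suc≢0 m eq with ℕ→ℚ-injective {suc m} {0} eq
... | ()

1-ℕ→ℚ≢0 : ∀ m → 1ℚ - ℕ→ℚ (suc (suc m)) ≢ 0ℚ
1-ℕ→ℚ≢0 m eq = ℕ→ℚ-suc≢0 m (begin
    ℕ→ℚ (suc m)                        ≡⟨ solve 1 (λ x → x := :- (con 1ℚ :- (con 1ℚ :+ x))) refl (ℕ→ℚ (suc m)) ⟩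
    - (1ℚ - (1ℚ + ℕ→ℚ (suc m)))        ≡⟨ cong (λ x → - (1ℚ - x)) (sym (ℕ→ℚ-suc (suc m))) ⟩
    - (1ℚ - ℕ→ℚ (suc (suc m)))         ≡⟨ cong -_ eq ⟩
    - 0ℚ                               ≡⟨ refl ⟩
    0ℚ                                 ∎)
  where open ≡-Reasoning

*-cancelʳ : ∀ {q x y} → q ≢ 0ℚ → x * q ≡ y * q → x ≡ y
*-cancelʳ {q} {x} {y} q≢0 eq = begin
    x                ≡⟨ sym (ℚP.*-identityʳ x) ⟩
    x * 1ℚ           ≡⟨ cong (x *_) (sym (ℚP.*-inverseʳ q)) ⟩
    x * (q * 1/ q)   ≡⟨ sym (ℚP.*-assoc x q (1/ q)) ⟩
    (x * q) * 1/ q   ≡⟨ cong (_* 1/ q) eq ⟩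
    (y * q) * 1/ q   ≡⟨ ℚP.*-assoc y q (1/ q) ⟩
    y * (q * 1/ q)   ≡⟨ cong (y *_) (ℚP.*-inverseʳ q) ⟩
    y * 1ℚ           ≡⟨ ℚP.*-identityʳ y ⟩
    y                ∎
  where
  open ≡-Reasoning
  instance
    q-nonZero : NonZero q
    q-nonZero = ≢-nonZero q≢0

*-nonZero : ∀ {x y} → x ≢ 0ℚ → y ≢ 0ℚ → x * y ≢ 0ℚ
*-nonZero {x} {y} x≢0 y≢0 xy≡0 = x≢0 (*-cancelʳ y≢0 (trans xy≡0 (sym (ℚP.*-zeroˡ y))))

^-nonZero : ∀ {x} e → x ≢ 0ℚ → x ^ℚ e ≢ 0ℚ
^-nonZero zero    x≢0 ()
^-nonZero (suc e) x≢0 = *-nonZero x≢0 (^-nonZero e x≢0)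

/ℚ-cancel : ∀ p {q} → q ≢ 0ℚ → (p /ℚ q) * q ≡ p
/ℚ-cancel p {q} q≢0 with q ℚP.≟ 0ℚ
... | yes q≡0 = ⊥-elim (q≢0 q≡0)
... | no q≢0′ = trans (ℚP.*-assoc p _ q)
                  (trans (cong (p *_) (ℚP.*-inverseˡ q {{≢-nonZero q≢0′}})) (ℚP.*-identityʳ p))

/ℚ-unique : ∀ {x p q} → q ≢ 0ℚ → x * q ≡ p → x ≡ p /ℚ q
/ℚ-unique {x} {p} q≢0 eq = *-cancelʳ q≢0 (trans eq (sym (/ℚ-cancel p q≢0)))

solve-for : ∀ {x a b D} → D ≢ 0ℚ → D * x ≡ a * b → x ≡ (a /ℚ D) * b
solve-for {x} {a} {b} {D} D≢0 eq = *-cancelʳ D≢0 (begin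
    x * D                ≡⟨ ℚP.*-comm x D ⟩
    D * x                ≡⟨ eq ⟩
    a * b                ≡⟨ cong (_* b) (sym (/ℚ-cancel a D≢0)) ⟩
    (a /ℚ D) * D * b     ≡⟨ solve 3 (λ p D b → p :* D :* b := p :* b :* D) refl (a /ℚ D) D b ⟩
    (a /ℚ D) * b * D     ∎)
  where open ≡-Reasoning

∑ : List X → (X → ℚ) → ℚ
∑ []      f = 0ℚ
∑ (x ∷ L) f = f x + ∑ L f

∏ : List X → (X → ℚ) → ℚ
∏ []      f = 1ℚ
∏ (x ∷ L) f = f x * ∏ L f

syntax ∑ L (λ x → e) = ∑[ x ∈ L ] e
syntax ∏ L (λ x → e) = ∏[ x ∈ L ] e

∑-cong : ∀ (L : List X) {f g : X → ℚ} → (∀ x → f x ≡ g x) → ∑ L f ≡ ∑ L g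
∑-cong []      eq = refl
∑-cong (x ∷ L) eq = cong₂ _+_ (eq x) (∑-cong L eq)

∏-cong : ∀ (L : List X) {f g : X → ℚ} → (∀ x → f x ≡ g x) → ∏ L f ≡ ∏ L g
∏-cong []      eq = refl
∏-cong (x ∷ L) eq = cong₂ _*_ (eq x) (∏-cong L eq)

∑-map : ∀ (L : List Y) (h : Y → X) f → ∑ (map h L) f ≡ ∑[ y ∈ L ] f (h y)
∑-map []      h f = refl
∑-map (y ∷ L) h f = cong (_+_ (f (h y))) (∑-map L h f)

sumℚ-map : ∀ (L : List X) f → sumℚ (map f L) ≡ ∑ L f
sumℚ-map []      f = refl
sumℚ-map (x ∷ L) f = cong (_+_ (f x)) (sumℚ-map L f)

∑-++ : ∀ (L M : List X) f → ∑ (L ++ M) f ≡ ∑ L f + ∑ M f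
∑-++ []      M f = sym (ℚP.+-identityˡ _)
∑-++ (x ∷ L) M f = trans (cong (_+_ (f x)) (∑-++ L M f)) (sym (ℚP.+-assoc (f x) (∑ L f) (∑ M f)))

∑-concatMap : ∀ (L : List Y) (g : Y → List X) f →
              ∑ (concatMap g L) f ≡ ∑[ y ∈ L ] ∑ (g y) f
∑-concatMap []      g f = refl
∑-concatMap (y ∷ L) g f = trans (∑-++ (g y) (concatMap g L) f) (cong (_+_ (∑ (g y) f)) (∑-concatMap L g f))

∑-zero : ∀ (L : List X) → ∑[ x ∈ L ] 0ℚ ≡ 0ℚ
∑-zero []      = refl
∑-zero (x ∷ L) = trans (ℚP.+-identityˡ _) (∑-zero L)

∑-+ : ∀ (L : List X) f g → ∑[ x ∈ L ] (f x + g x) ≡ ∑ L f + ∑ L g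
∑-+ []      f g = sym (ℚP.+-identityˡ _)
∑-+ (x ∷ L) f g = trans (cong (_+_ (f x + g x)) (∑-+ L f g)) (swap (f x) (g x) (∑ L f) (∑ L g))
  where
  swap : ∀ a b c d → (a + b) + (c + d) ≡ (a + c) + (b + d)
  swap = solve 4 (λ a b c d → (a :+ b) :+ (c :+ d) := (a :+ c) :+ (b :+ d)) refl

∑-*ˡ : ∀ (L : List X) c f → c * ∑ L f ≡ ∑[ x ∈ L ] (c * f x)
∑-*ˡ []      c f = ℚP.*-zeroʳ c
∑-*ˡ (x ∷ L) c f = trans (ℚP.*-distribˡ-+ c _ _) (cong (_+_ (c * f x)) (∑-*ˡ L c f))

∑-swap : ∀ (L : List X) (M : List Y) (f : X → Y → ℚ) →
         ∑[ x ∈ L ] ∑ M (f x) ≡ ∑[ y ∈ M ] ∑[ x ∈ L ] f x y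
∑-swap []      M f = sym (∑-zero M)
∑-swap (x ∷ L) M f = trans (cong (_+_ (∑ M (f x))) (∑-swap L M f)) (sym (∑-+ M (f x) _))

∑-allFin-suc : ∀ m (f : Fin (suc m) → ℚ) → ∑ (allFin (suc m)) f ≡ f zero + ∑[ a ∈ allFin m ] f (suc a)
∑-allFin-suc m f = cong (_+_ (f zero)) (trans (cong (λ L → ∑ L f) (sym (ListP.map-tabulate id suc))) (∑-map (allFin m) suc f))

∑-const : ∀ m c → ∑[ a ∈ allFin m ] c ≡ ℕ→ℚ m * c
∑-const zero    c = sym (ℚP.*-zeroˡ c)
∑-const (suc m) c = begin
    ∑[ a ∈ allFin (suc m) ] c  ≡⟨ ∑-allFin-suc m (λ _ → c) ⟩
    c + ∑[ a ∈ allFin m ] c    ≡⟨ cong (_+_ c) (∑-const m c) ⟩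
    c + ℕ→ℚ m * c              ≡⟨ cong (_+ ℕ→ℚ m * c) (sym (ℚP.*-identityˡ c)) ⟩
    1ℚ * c + ℕ→ℚ m * c         ≡⟨ sym (ℚP.*-distribʳ-+ c 1ℚ (ℕ→ℚ m)) ⟩
    (1ℚ + ℕ→ℚ m) * c           ≡⟨ cong (_* c) (sym (ℕ→ℚ-suc m)) ⟩
    ℕ→ℚ (suc m) * c            ∎
  where open ≡-Reasoning

∏-scale : ∀ (L : List X) c f → c ^ℚ length L * ∏ L f ≡ ∏[ x ∈ L ] (c * f x)
∏-scale []      c f = ℚP.*-identityˡ 1ℚ
∏-scale (x ∷ L) c f = trans (regroup c (c ^ℚ length L) (f x) (∏ L f)) (cong (c * f x *_) (∏-scale L c f))
  where
  regroup : ∀ c p a b → (c * p) * (a * b) ≡ (c * a) * (p * b)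
  regroup = solve 4 (λ c p a b → (c :* p) :* (a :* b) := (c :* a) :* (p :* b)) refl

𝟙 : ∀ {P : Set} → Dec P → ℚ
𝟙 (yes _) = 1ℚ
𝟙 (no _)  = 0ℚ

𝟙-cong : ∀ {P Q : Set} → P ⇔ Q → (p : Dec P) (q : Dec Q) → 𝟙 p ≡ 𝟙 q
𝟙-cong P⇔Q (yes _) (yes _) = refl
𝟙-cong P⇔Q (yes p) (no ¬q) = ⊥-elim (¬q (Equivalence.to P⇔Q p))
𝟙-cong P⇔Q (no ¬p) (yes q) = ⊥-elim (¬p (Equivalence.from P⇔Q q))
𝟙-cong P⇔Q (no _)  (no _)  = refl

𝟙-yes : ∀ {P : Set} → P → (p : Dec P) → 𝟙 p ≡ 1ℚ
𝟙-yes _ (yes _) = refl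
𝟙-yes p (no ¬p) = ⊥-elim (¬p p)

𝟙-no : ∀ {P : Set} → ¬ P → (p : Dec P) → 𝟙 p ≡ 0ℚ
𝟙-no ¬p (yes p) = ⊥-elim (¬p p)
𝟙-no _  (no _)  = refl

𝟙-× : ∀ {P Q : Set} (p : Dec P) (q : Dec Q) (r : Dec (P × Q)) → 𝟙 r ≡ 𝟙 p * 𝟙 q
𝟙-× (yes p) (yes q) r = 𝟙-yes (p , q) r
𝟙-× (yes _) (no ¬q) r = 𝟙-no (¬q ∘ proj₂) r
𝟙-× (no ¬p) q       r = trans (𝟙-no (¬p ∘ proj₁) r) (sym (ℚP.*-zeroˡ (𝟙 q)))

𝟙-¬ : ∀ {P : Set} (p : Dec P) → 𝟙 (¬? p) ≡ 1ℚ - 𝟙 p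
𝟙-¬ (yes _) = refl
𝟙-¬ (no _)  = refl

𝟙-guard : ∀ {P : Set} (p : Dec P) {x y} → (P → x ≡ y) → 𝟙 p * x ≡ 𝟙 p * y
𝟙-guard (yes p) eq = cong (1ℚ *_) (eq p)
𝟙-guard (no _)  {x} {y} eq = trans (ℚP.*-zeroˡ x) (sym (ℚP.*-zeroˡ y))

𝟙-all : ∀ {P : X → Set} (P? : Decidable P) (L : List X) →
        𝟙 (All.all? P? L) ≡ ∏[ x ∈ L ] 𝟙 (P? x)
𝟙-all P? []      = refl
𝟙-all P? (x ∷ L) = begin
    𝟙 (All.all? P? (x ∷ L))               ≡⟨ 𝟙-cong (mk⇔ All.uncons (λ (p , ps) → p ∷ ps)) (All.all? P? (x ∷ L)) (P? x ×-dec All.all? P? L) ⟩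
    𝟙 (P? x ×-dec All.all? P? L)          ≡⟨ 𝟙-× (P? x) (All.all? P? L) (P? x ×-dec All.all? P? L) ⟩
    𝟙 (P? x) * 𝟙 (All.all? P? L)          ≡⟨ cong (𝟙 (P? x) *_) (𝟙-all P? L) ⟩
    𝟙 (P? x) * ∏[ y ∈ L ] 𝟙 (P? y)        ∎
  where open ≡-Reasoning

count-∑ : ∀ {P : X → Set} (P? : Decidable P) (L : List X) →
          ℕ→ℚ (count P? L) ≡ ∑[ x ∈ L ] 𝟙 (P? x)
count-∑ P? []      = refl
count-∑ P? (x ∷ L) with P? x
... | yes _ = trans (ℕ→ℚ-suc (count P? L)) (cong (_+_ 1ℚ) (count-∑ P? L))
... | no _  = trans (count-∑ P? L) (sym (ℚP.+-identityˡ _))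

∑-δ : ∀ {m} (c : Fin m) (g : Fin m → ℚ) → ∑[ a ∈ allFin m ] (𝟙 (c FinP.≟ a) * g a) ≡ g c
∑-δ {suc m} zero    g = begin
    ∑[ a ∈ allFin (suc m) ] (𝟙 (zero FinP.≟ a) * g a)  ≡⟨ ∑-allFin-suc m (λ a → 𝟙 (zero FinP.≟ a) * g a) ⟩
    1ℚ * g zero + ∑[ a ∈ allFin m ] (0ℚ * g (suc a))  ≡⟨ cong₂ _+_ (ℚP.*-identityˡ (g zero))
                                                           (trans (∑-cong (allFin m) (λ a → ℚP.*-zeroˡ (g (suc a)))) (∑-zero (allFin m))) ⟩
    g zero + 0ℚ                                         ≡⟨ ℚP.+-identityʳ (g zero) ⟩
    g zero                                              ∎
  where open ≡-Reasoning
∑-δ {suc m} (suc c) g = begin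
    ∑[ a ∈ allFin (suc m) ] (𝟙 (suc c FinP.≟ a) * g a)  ≡⟨ ∑-allFin-suc m (λ a → 𝟙 (suc c FinP.≟ a) * g a) ⟩
    0ℚ * g zero + ∑[ a ∈ allFin m ] (𝟙 (suc c FinP.≟ suc a) * g (suc a))
      ≡⟨ cong₂ _+_ (ℚP.*-zeroˡ (g zero))
               (∑-cong (allFin m) (λ a → cong (_* g (suc a)) (𝟙-cong (mk⇔ FinP.suc-injective (cong suc)) (suc c FinP.≟ suc a) (c FinP.≟ a)))) ⟩
    0ℚ + ∑[ a ∈ allFin m ] (𝟙 (c FinP.≟ a) * g (suc a))  ≡⟨ ℚP.+-identityˡ _ ⟩
    ∑[ a ∈ allFin m ] (𝟙 (c FinP.≟ a) * g (suc a))       ≡⟨ ∑-δ c (g ∘ suc) ⟩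
    g (suc c)                                             ∎
  where open ≡-Reasoning

-- The binomially weighted subset sum
--   ∑⊆[ α , β ] E f  =  ∑_{A ⊆ E} α^|A| β^|E ∖ A| f(A),
-- defined by deciding, edge by edge, whether it belongs to A.
∑⊆[_,_] : ℚ → ℚ → List X → (List X → ℚ) → ℚ
∑⊆[ α , β ] []      f = f []
∑⊆[ α , β ] (e ∷ E) f = α * ∑⊆[ α , β ] E (f ∘ (e ∷_)) + β * ∑⊆[ α , β ] E f

∑⊆-cong : ∀ α β (E : List X) {f g : List X → ℚ} → (∀ A → f A ≡ g A) → ∑⊆[ α , β ] E f ≡ ∑⊆[ α , β ] E g
∑⊆-cong α β []      eq = eq []
∑⊆-cong α β (e ∷ E) eq = cong₂ (λ p q → α * p + β * q) (∑⊆-cong α β E (eq ∘ (e ∷_))) (∑⊆-cong α β E eq)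

∑⊆-*ˡ : ∀ α β (E : List X) c f → ∑⊆[ α , β ] E (λ A → c * f A) ≡ c * ∑⊆[ α , β ] E f
∑⊆-*ˡ α β []      c f = refl
∑⊆-*ˡ α β (e ∷ E) c f = trans (cong₂ (λ p q → α * p + β * q) (∑⊆-*ˡ α β E c (f ∘ (e ∷_))) (∑⊆-*ˡ α β E c f))
                                (factor α β c _ _)
  where
  factor : ∀ α β c x y → α * (c * x) + β * (c * y) ≡ c * (α * x + β * y)
  factor = solve 5 (λ α β c x y → α :* (c :* x) :+ β :* (c :* y) := c :* (α :* x :+ β :* y)) refl

∑⊆-∑ : ∀ α β (E : List X) (L : List Y) (f : Y → List X → ℚ) →
       ∑⊆[ α , β ] E (λ A → ∑[ y ∈ L ] f y A) ≡ ∑[ y ∈ L ] ∑⊆[ α , β ] E (f y)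
∑⊆-∑ α β []      L f = refl
∑⊆-∑ α β (e ∷ E) L f = begin
    α * ∑⊆[ α , β ] E (λ A → ∑[ y ∈ L ] f y (e ∷ A)) + β * ∑⊆[ α , β ] E (λ A → ∑[ y ∈ L ] f y A)
      ≡⟨ cong₂ (λ p q → α * p + β * q) (∑⊆-∑ α β E L (λ y → f y ∘ (e ∷_))) (∑⊆-∑ α β E L f) ⟩
    α * ∑[ y ∈ L ] ∑⊆[ α , β ] E (f y ∘ (e ∷_)) + β * ∑[ y ∈ L ] ∑⊆[ α , β ] E (f y)
      ≡⟨ cong₂ _+_ (∑-*ˡ L α _) (∑-*ˡ L β _) ⟩
    ∑[ y ∈ L ] (α * ∑⊆[ α , β ] E (f y ∘ (e ∷_))) + ∑[ y ∈ L ] (β * ∑⊆[ α , β ] E (f y))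
      ≡⟨ sym (∑-+ L _ _) ⟩
    ∑[ y ∈ L ] ∑⊆[ α , β ] (e ∷ E) (f y) ∎
  where open ≡-Reasoning

∑⊆-rescale : ∀ c α β (E : List X) f → ∑⊆[ c * α , β ] E f ≡ ∑⊆[ α , β ] E (λ A → c ^ℚ length A * f A)
∑⊆-rescale c α β []      f = sym (ℚP.*-identityˡ (f []))
∑⊆-rescale {X = X} c α β (e ∷ E) f = cong₂ _+_ chosen (cong (β *_) (∑⊆-rescale c α β E f))
  where
  open ≡-Reasoning
  g : List X → ℚ
  g A = c ^ℚ length A * f (e ∷ A)
  chosen : (c * α) * ∑⊆[ c * α , β ] E (f ∘ (e ∷_)) ≡ α * ∑⊆[ α , β ] E (λ A → c ^ℚ length (e ∷ A) * f (e ∷ A))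
  chosen = begin
    (c * α) * ∑⊆[ c * α , β ] E (f ∘ (e ∷_))  ≡⟨ cong ((c * α) *_) (∑⊆-rescale c α β E (f ∘ (e ∷_))) ⟩
    (c * α) * ∑⊆[ α , β ] E g                 ≡⟨ solve 3 (λ c α x → (c :* α) :* x := α :* (c :* x)) refl c α _ ⟩
    α * (c * ∑⊆[ α , β ] E g)                 ≡⟨ cong (α *_) (sym (∑⊆-*ˡ α β E c g)) ⟩
    α * ∑⊆[ α , β ] E (λ A → c * g A)         ≡⟨ cong (α *_) (∑⊆-cong α β E (λ A → sym (ℚP.*-assoc c _ _))) ⟩
    α * ∑⊆[ α , β ] E (λ A → c ^ℚ length (e ∷ A) * f (e ∷ A)) ∎

∑⊆-∏ : ∀ α β (E : List X) x → ∑⊆[ α , β ] E (λ A → ∏ A x) ≡ ∏[ e ∈ E ] (α * x e + β)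
∑⊆-∏ α β []      x = refl
∑⊆-∏ α β (e ∷ E) x = begin
    α * ∑⊆[ α , β ] E (λ A → x e * ∏ A x) + β * ∑⊆[ α , β ] E (λ A → ∏ A x)
      ≡⟨ cong (λ p → α * p + β * ∑⊆[ α , β ] E (λ A → ∏ A x)) (∑⊆-*ˡ α β E (x e) (λ A → ∏ A x)) ⟩
    α * (x e * ∑⊆[ α , β ] E (λ A → ∏ A x)) + β * ∑⊆[ α , β ] E (λ A → ∏ A x)
      ≡⟨ cong (λ p → α * (x e * p) + β * p) (∑⊆-∏ α β E x) ⟩
    α * (x e * P) + β * P
      ≡⟨ solve 4 (λ α β y P → α :* (y :* P) :+ β :* P := (α :* y :+ β) :* P) refl α β (x e) P ⟩
    (α * x e + β) * P ∎
  where
  open ≡-Reasoning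
  P : ℚ
  P = ∏[ e ∈ E ] (α * x e + β)

∑⊆-sublists : ∀ {α β γ} → α * γ ≡ β → γ ≢ 0ℚ → (E : List X) (f : List X → ℚ) →
              β ^ℚ length E * ∑[ A ∈ sublists E ] (f A /ℚ (γ ^ℚ length A)) ≡ ∑⊆[ α , β ] E f
∑⊆-sublists {X = X} {α} {β} {γ} αγ≡β γ≢0 = go
  where
  open ≡-Reasoning
  shiftWeight : ∀ p e → β * (p /ℚ (γ ^ℚ suc e)) ≡ α * (p /ℚ (γ ^ℚ e))
  shiftWeight p e = *-cancelʳ (^-nonZero (suc e) γ≢0) (begin
      β * (p /ℚ (γ ^ℚ suc e)) * γ ^ℚ suc e    ≡⟨ ℚP.*-assoc β _ _ ⟩
      β * ((p /ℚ (γ ^ℚ suc e)) * γ ^ℚ suc e)  ≡⟨ cong (β *_) (/ℚ-cancel p (^-nonZero (suc e) γ≢0)) ⟩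
      β * p                                  ≡⟨ cong (_* p) (sym αγ≡β) ⟩
      α * γ * p                              ≡⟨ cong (α * γ *_) (sym (/ℚ-cancel p (^-nonZero e γ≢0))) ⟩
      α * γ * ((p /ℚ (γ ^ℚ e)) * γ ^ℚ e)      ≡⟨ solve 4 (λ α γ q r → α :* γ :* (q :* r) := α :* q :* (γ :* r)) refl α γ _ _ ⟩
      α * (p /ℚ (γ ^ℚ e)) * γ ^ℚ suc e        ∎)

  go : (E : List X) (f : List X → ℚ) →
       β ^ℚ length E * ∑[ A ∈ sublists E ] (f A /ℚ (γ ^ℚ length A)) ≡ ∑⊆[ α , β ] E f
  go [] f = begin
    1ℚ * (f [] /ℚ 1ℚ + 0ℚ)  ≡⟨ ℚP.*-identityˡ _ ⟩
    f [] /ℚ 1ℚ + 0ℚ         ≡⟨ ℚP.+-identityʳ _ ⟩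
    f [] /ℚ 1ℚ              ≡⟨ sym (/ℚ-unique (λ ()) (ℚP.*-identityʳ (f []))) ⟩
    f []                    ∎
  go (e ∷ E) f = begin
    β ^ℚ suc m * ∑ (map (e ∷_) (sublists E) ++ sublists E) h
      ≡⟨ cong (β ^ℚ suc m *_) (trans (∑-++ (map (e ∷_) (sublists E)) (sublists E) h)
                                     (cong (_+ ∑ (sublists E) h) (∑-map (sublists E) (e ∷_) h))) ⟩
    β ^ℚ suc m * (∑[ A ∈ sublists E ] h (e ∷ A) + S)
      ≡⟨ solve 4 (λ b p x y → (b :* p) :* (x :+ y) := p :* (b :* x) :+ b :* (p :* y)) refl β (β ^ℚ m) _ S ⟩
    β ^ℚ m * (β * ∑[ A ∈ sublists E ] h (e ∷ A)) + β * (β ^ℚ m * S)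
      ≡⟨ cong (λ p → β ^ℚ m * p + β * (β ^ℚ m * S)) (trans (∑-*ˡ (sublists E) β _)
           (trans (∑-cong (sublists E) (λ A → shiftWeight (f (e ∷ A)) (length A))) (sym (∑-*ˡ (sublists E) α _)))) ⟩
    β ^ℚ m * (α * ∑[ A ∈ sublists E ] (f (e ∷ A) /ℚ (γ ^ℚ length A))) + β * (β ^ℚ m * S)
      ≡⟨ cong (_+ β * (β ^ℚ m * S)) (solve 3 (λ p a x → p :* (a :* x) := a :* (p :* x)) refl (β ^ℚ m) α _) ⟩
    α * (β ^ℚ m * ∑[ A ∈ sublists E ] (f (e ∷ A) /ℚ (γ ^ℚ length A))) + β * (β ^ℚ m * S)
      ≡⟨ cong₂ (λ p q → α * p + β * q) (go E (f ∘ (e ∷_))) (go E f) ⟩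
    ∑⊆[ α , β ] (e ∷ E) f ∎
    where
    m : ℕ
    m = length E
    h : List X → ℚ
    h A = f A /ℚ (γ ^ℚ length A)
    S : ℚ
    S = ∑ (sublists E) h

module Modulus (k′ : ℕ) where

  k : ℕ
  k = suc k′

  K : ℚ
  K = ℕ→ℚ k

  k∣_ : ℤ → Set
  k∣ x = + k ∣ x

  k∣? : Decidable k∣_
  k∣? x = + k ∣? x

  k∣-zero : k∣ (+ 0)
  k∣-zero = divides (+ 0) (sym (ℤP.*-zeroˡ (+ k)))

  k∣-negate : ∀ {x} → k∣ (ℤ.- x) → k∣ x
  k∣-negate {x} k∣-x = subst k∣_ (ℤP.neg-involutive x) (∣m⇒∣-m k∣-x)

  k∣-small : ∀ {x} → k∣ x → ℤ.∣ x ∣ ℕ.< k → x ≡ 0ℤ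
  k∣-small {x} k∣x ∣x∣<k with ℤ.∣ x ∣ ℕ.≟ 0
  ... | yes ∣x∣≡0 = ℤP.∣i∣≡0⇒i≡0 ∣x∣≡0
  ... | no ∣x∣≢0  = ⊥-elim (ℕP.<⇒≱ ∣x∣<k (ℕD.∣⇒≤ {{ℕ.≢-nonZero ∣x∣≢0}} (∣⇒∣ᵤ k∣x)))

  residue-unique : ∀ {a r} → a ℕ.< k → r ℕ.< k → k∣ (+ a ℤ.- + r) → a ≡ r
  residue-unique {a} {r} a<k r<k k∣a-r = ℤP.+-injective (ℤP.i-j≡0⇒i≡j (+ a) (+ r) (k∣-small k∣a-r small))
    where
    small : ℤ.∣ + a ℤ.- + r ∣ ℕ.< k
    small = subst (ℕ._< k) (cong ℤ.∣_∣ (sym (ℤP.m-n≡m⊖n a r)))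
                  (ℕP.≤-<-trans (ℤP.∣m⊝n∣≤m⊔n a r) (ℕP.⊔-lub a<k r<k))

  residue-exists : ∀ c → ∃[ r ] k∣ (c ℤ.+ + toℕ r)
  residue-exists c = r , subst k∣_ (negate c (+ toℕ r)) (∣m⇒∣-m (divides q -c-r≡qk))
    where
    r< : (ℤ.- c) %ℕ k ℕ.< k
    r< = n%ℕd<d (ℤ.- c) k
    r : Fin k
    r = fromℕ< r<
    q : ℤ
    q = (ℤ.- c) /ℕ k
    -c≡r+qk : ℤ.- c ≡ + toℕ r ℤ.+ q ℤ.* + k
    -c≡r+qk = trans (a≡a%ℕn+[a/ℕn]*n (ℤ.- c) k) (cong (λ z → + z ℤ.+ q ℤ.* + k) (sym (FinP.toℕ-fromℕ< r<)))
    cancel : ∀ r q k → (r ℤ.+ q ℤ.* k) ℤ.- r ≡ q ℤ.* k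
    cancel = solve-∀
    -c-r≡qk : ℤ.- c ℤ.- + toℕ r ≡ q ℤ.* + k
    -c-r≡qk = trans (cong (λ z → z ℤ.- + toℕ r) -c≡r+qk) (cancel (+ toℕ r) q (+ k))
    negate : ∀ c r → ℤ.- (ℤ.- c ℤ.- r) ≡ c ℤ.+ r
    negate = solve-∀

  ∑-residue : ∀ c → ∑[ a ∈ allFin k ] 𝟙 (k∣? (c ℤ.+ + toℕ a)) ≡ 1ℚ
  ∑-residue c with residue-exists c
  ... | r , k∣c+r = begin
      ∑[ a ∈ allFin k ] 𝟙 (k∣? (c ℤ.+ + toℕ a))   ≡⟨ ∑-cong (allFin k) hit ⟩
      ∑[ a ∈ allFin k ] 𝟙 (r FinP.≟ a)            ≡⟨ ∑-cong (allFin k) (λ a → sym (ℚP.*-identityʳ (𝟙 (r FinP.≟ a)))) ⟩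
      ∑[ a ∈ allFin k ] (𝟙 (r FinP.≟ a) * 1ℚ)     ≡⟨ ∑-δ r (const 1ℚ) ⟩
      1ℚ                                          ∎
    where
    open ≡-Reasoning
    hit⇒ : ∀ a → r ≡ a → k∣ (c ℤ.+ + toℕ a)
    hit⇒ a refl = k∣c+r
    cancel : ∀ c a r → (c ℤ.+ a) ℤ.- (c ℤ.+ r) ≡ a ℤ.- r
    cancel = solve-∀
    hits : ∀ a → k∣ (c ℤ.+ + toℕ a) → r ≡ a
    hits a k∣c+a = FinP.toℕ-injective (sym (residue-unique (FinP.toℕ<n a) (FinP.toℕ<n r)
                     (subst k∣_ (cancel c (+ toℕ a) (+ toℕ r)) (∣m∣n⇒∣m-n k∣c+a k∣c+r))))
    hit : ∀ a → 𝟙 (k∣? (c ℤ.+ + toℕ a)) ≡ 𝟙 (r FinP.≟ a)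
    hit a = 𝟙-cong (mk⇔ (hits a) (hit⇒ a)) (k∣? (c ℤ.+ + toℕ a)) (r FinP.≟ a)

Edge : ℕ → Set
Edge d = Fin d × Fin d

module Identify {d : ℕ} (u v : Fin d) where

  ρ : Fin d → Fin d
  ρ x with x FinP.≟ v
  ... | yes _ = u
  ... | no _  = x

  ρ-view : ∀ x → (x ≡ v × ρ x ≡ u) ⊎ (x ≢ v × ρ x ≡ x)
  ρ-view x with x FinP.≟ v
  ... | yes x≡v = inj₁ (x≡v , refl)
  ... | no x≢v  = inj₂ (x≢v , refl)

  ρe : Edge d → Edge d
  ρe (x , y) = ρ x , ρ y

-- Colourings of Fin d with k = suc k′ colours, enumerated as in Defs. The
-- same enumeration lists the value assignments Fin m → ℤ/k on m edges.
module Colorings (k′ : ℕ) where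

  open Modulus k′

  Coloring : ℕ → Set
  Coloring d = Fin d → Fin k

  colorings : (d : ℕ) → List (Coloring d)
  colorings d = allFuns (allFin k) d

  Extensional : ∀ {d} → (Coloring d → ℚ) → Set
  Extensional F = ∀ {s t} → s ≗ t → F s ≡ F t

  _[_≔_] : ∀ {d} → Coloring d → Fin d → Fin k → Coloring d
  s [ v ≔ a ] = updateAt s v (const a)

  ≔-same : ∀ {d} (s : Coloring d) v a → (s [ v ≔ a ]) v ≡ a
  ≔-same s v a = updateAt-updates v s

  ≔-other : ∀ {d} (s : Coloring d) {v w} a → w ≢ v → (s [ v ≔ a ]) w ≡ s w
  ≔-other s {v} {w} a w≢v = updateAt-minimal w v s w≢v

  ∑-colorings-suc : ∀ d F → ∑ (colorings (suc d)) F ≡ ∑[ a ∈ allFin k ] ∑[ s ∈ colorings d ] F (a ◂ s)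
  ∑-colorings-suc d F = trans (∑-concatMap (allFin k) (λ a → map (a ◂_) (colorings d)) F)
                              (∑-cong (allFin k) (λ a → ∑-map (colorings d) (a ◂_) F))

  ∑-colorings-1 : ∀ d → ∑[ s ∈ colorings d ] 1ℚ ≡ K ^ℚ d
  ∑-colorings-1 zero    = ℚP.+-identityʳ 1ℚ
  ∑-colorings-1 (suc d) = begin
      ∑[ s ∈ colorings (suc d) ] 1ℚ              ≡⟨ ∑-colorings-suc d (const 1ℚ) ⟩
      ∑[ a ∈ allFin k ] ∑[ s ∈ colorings d ] 1ℚ  ≡⟨ ∑-cong (allFin k) (λ _ → ∑-colorings-1 d) ⟩
      ∑[ a ∈ allFin k ] (K ^ℚ d)                 ≡⟨ ∑-const k (K ^ℚ d) ⟩
      K ^ℚ suc d                                 ∎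
    where open ≡-Reasoning

  ∑-recolor : ∀ d (v : Fin d) (F : Coloring d → ℚ) → Extensional F →
              ∑[ s ∈ colorings d ] ∑[ a ∈ allFin k ] F (s [ v ≔ a ]) ≡ K * ∑ (colorings d) F
  ∑-recolor (suc d) zero F ext = begin
      ∑[ s ∈ colorings (suc d) ] ∑[ a ∈ allFin k ] F (s [ zero ≔ a ])
        ≡⟨ ∑-colorings-suc d _ ⟩
      ∑[ b ∈ allFin k ] ∑[ s ∈ colorings d ] ∑[ a ∈ allFin k ] F ((b ◂ s) [ zero ≔ a ])
        ≡⟨ ∑-cong (allFin k) (λ b → ∑-cong (colorings d) (λ s → ∑-cong (allFin k) (λ a → ext (head≔ b s a)))) ⟩
      ∑[ b ∈ allFin k ] ∑[ s ∈ colorings d ] ∑[ a ∈ allFin k ] F (a ◂ s)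
        ≡⟨ ∑-const k _ ⟩
      K * ∑[ s ∈ colorings d ] ∑[ a ∈ allFin k ] F (a ◂ s)
        ≡⟨ cong (K *_) (trans (∑-swap (colorings d) (allFin k) _) (sym (∑-colorings-suc d F))) ⟩
      K * ∑ (colorings (suc d)) F ∎
    where
    open ≡-Reasoning
    head≔ : ∀ b s a → (b ◂ s) [ zero ≔ a ] ≗ a ◂ s
    head≔ b s a zero    = refl
    head≔ b s a (suc i) = refl
  ∑-recolor (suc d) (suc v) F ext = begin
      ∑[ s ∈ colorings (suc d) ] ∑[ a ∈ allFin k ] F (s [ suc v ≔ a ])
        ≡⟨ ∑-colorings-suc d _ ⟩
      ∑[ b ∈ allFin k ] ∑[ s ∈ colorings d ] ∑[ a ∈ allFin k ] F ((b ◂ s) [ suc v ≔ a ])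
        ≡⟨ ∑-cong (allFin k) (λ b → ∑-cong (colorings d) (λ s → ∑-cong (allFin k) (λ a → ext (tail≔ b s a)))) ⟩
      ∑[ b ∈ allFin k ] ∑[ s ∈ colorings d ] ∑[ a ∈ allFin k ] F (b ◂ (s [ v ≔ a ]))
        ≡⟨ ∑-cong (allFin k) (λ b → ∑-recolor d v (F ∘ (b ◂_)) (λ eq → ext (cons-cong b eq))) ⟩
      ∑[ b ∈ allFin k ] (K * ∑[ s ∈ colorings d ] F (b ◂ s))
        ≡⟨ sym (trans (cong (K *_) (∑-colorings-suc d F)) (∑-*ˡ (allFin k) K _)) ⟩
      K * ∑ (colorings (suc d)) F ∎
    where
    open ≡-Reasoning
    tail≔ : ∀ b s a → (b ◂ s) [ suc v ≔ a ] ≗ b ◂ (s [ v ≔ a ])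
    tail≔ b s a zero    = refl
    tail≔ b s a (suc i) = refl
    cons-cong : ∀ b {s t : Coloring d} → s ≗ t → b ◂ s ≗ b ◂ t
    cons-cong b eq zero    = refl
    cons-cong b eq (suc i) = eq i

module Monochromatic (k′ d : ℕ) where

  open Modulus k′
  open Colorings k′

  same : Fin k → Fin k → ℚ
  same a b = 𝟙 (a FinP.≟ b)

  mono : List (Edge d) → Coloring d → ℚ
  mono A s = ∏[ e ∈ A ] same (s (proj₁ e)) (s (proj₂ e))

  -- the number of such colourings (k to the number of components of A)
  monoCount : List (Edge d) → ℚ
  monoCount A = ∑ (colorings d) (mono A)

  mono-ext : ∀ A → Extensional (mono A)
  mono-ext A s≗t = ∏-cong A (λ e → cong₂ same (s≗t (proj₁ e)) (s≗t (proj₂ e)))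

  monoCount-loop : ∀ x A → monoCount ((x , x) ∷ A) ≡ monoCount A
  monoCount-loop x A = ∑-cong (colorings d) (λ s →
    trans (cong (_* mono A s) (𝟙-yes refl (s x FinP.≟ s x))) (ℚP.*-identityˡ (mono A s)))

  -- Contracting the non-loop edge u → v: colourings constant along the
  -- contracted edges are colourings constant along (u → v) ∷ A with the
  -- colour of v forgotten, i.e. k times as many.
  module MonoContraction (u v : Fin d) (u≢v : u ≢ v) where

    open Identify u v

    σ : Coloring d → Coloring d
    σ s = s [ v ≔ s u ]

    ρ-σ : ∀ s x → s (ρ x) ≡ σ s x
    ρ-σ s x with ρ-view x
    ... | inj₁ (refl , ρv≡u) = trans (cong s ρv≡u) (sym (≔-same s v (s u)))
    ... | inj₂ (x≢v , ρx≡x)  = trans (cong s ρx≡x) (sym (≔-other s (s u) x≢v))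

    mono-map : ∀ A s → mono (map ρe A) s ≡ mono A (σ s)
    mono-map []      s = refl
    mono-map ((x , y) ∷ A) s = cong₂ _*_ (cong₂ same (ρ-σ s x) (ρ-σ s y)) (mono-map A s)

    σ-cong : ∀ {s t} → s ≗ t → σ s ≗ σ t
    σ-cong {s} {t} s≗t w with w FinP.≟ v
    ... | yes refl = trans (≔-same s w (s u)) (trans (s≗t u) (sym (≔-same t w (t u))))
    ... | no w≢v   = trans (≔-other s (s u) w≢v) (trans (s≗t w) (sym (≔-other t (t u) w≢v)))

    σ-recolor : ∀ s a → σ (s [ v ≔ a ]) ≗ σ s
    σ-recolor s a w with w FinP.≟ v
    ... | yes refl = trans (≔-same _ w _) (trans (≔-other s a u≢v) (sym (≔-same s w (s u))))
    ... | no w≢v   = trans (≔-other _ _ w≢v) (trans (≔-other s a w≢v) (sym (≔-other s (s u) w≢v)))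

    σ-fixes : ∀ s → s u ≡ s v → σ s ≗ s
    σ-fixes s su≡sv w with w FinP.≟ v
    ... | yes refl = trans (≔-same s w (s u)) su≡sv
    ... | no w≢v   = ≔-other s (s u) w≢v

    monoCount-contract : ∀ A → monoCount (map ρe A) ≡ K * monoCount ((u , v) ∷ A)
    monoCount-contract A = begin
      ∑[ s ∈ colorings d ] mono (map ρe A) s
        ≡⟨ ∑-cong (colorings d) (mono-map A) ⟩
      ∑[ s ∈ colorings d ] h s
        ≡⟨ ∑-cong (colorings d) (λ s → sym (∑-δ (s u) (λ _ → h s))) ⟩
      ∑[ s ∈ colorings d ] ∑[ a ∈ allFin k ] (same (s u) a * h s)
        ≡⟨ ∑-cong (colorings d) (λ s → ∑-cong (allFin k) (λ a → sym (F-recolor s a))) ⟩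
      ∑[ s ∈ colorings d ] ∑[ a ∈ allFin k ] F (s [ v ≔ a ])
        ≡⟨ ∑-recolor d v F F-ext ⟩
      K * ∑[ s ∈ colorings d ] F s
        ≡⟨ cong (K *_) (∑-cong (colorings d) (λ s → 𝟙-guard (s u FinP.≟ s v) (λ su≡sv → mono-ext A (σ-fixes s su≡sv)))) ⟩
      K * monoCount ((u , v) ∷ A) ∎
      where
      open ≡-Reasoning
      h : Coloring d → ℚ
      h s = mono A (σ s)
      F : Coloring d → ℚ
      F s = same (s u) (s v) * h s
      F-ext : Extensional F
      F-ext s≗t = cong₂ _*_ (cong₂ same (s≗t u) (s≗t v)) (mono-ext A (σ-cong s≗t))
      F-recolor : ∀ s a → F (s [ v ≔ a ]) ≡ same (s u) a * h s
      F-recolor s a = cong₂ _*_ (cong₂ same (≔-other s a u≢v) (≔-same s v a)) (mono-ext A (σ-recolor s a))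

-- ℤ/k-valued flows on an edge list over the vertex set Fin d, counted with
-- a prescribed demand (required net outflow) at every vertex.
module Flows (k′ d : ℕ) where

  open Modulus k′

  Demand : Set
  Demand = Fin d → ℤ

  noDemand : Demand
  noDemand _ = + 0

  Balanced : Demand → Set
  Balanced b = ∀ w → k∣ b w

  balanced? : ∀ b → Dec (Balanced b)
  balanced? b = FinP.all? (k∣? ∘ b)

  δ : Fin d → Fin d → ℤ
  δ x w with x FinP.≟ w
  ... | yes _ = + 1
  ... | no _  = + 0

  δ-same : ∀ x → δ x x ≡ + 1
  δ-same x with x FinP.≟ x
  ... | yes _  = refl
  ... | no x≢x = ⊥-elim (x≢x refl)

  δ-diff : ∀ {x w} → x ≢ w → δ x w ≡ + 0
  δ-diff {x} {w} x≢w with x FinP.≟ w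
  ... | yes x≡w = ⊥-elim (x≢w x≡w)
  ... | no _    = refl

  -- the demand still to be met after sending a units along the edge x → y
  residual : Demand → Edge d → Fin k → Demand
  residual b (x , y) a w = b w ℤ.- + toℕ a ℤ.* (δ x w ℤ.- δ y w)

  flows : (Fin k → ℚ) → List (Edge d) → Demand → ℚ
  flows wt []      b = 𝟙 (balanced? b)
  flows wt (e ∷ A) b = ∑[ a ∈ allFin k ] (wt a * flows wt A (residual b e a))

  nonzero : Fin k → ℚ
  nonzero a = 𝟙 (¬? (toℕ a ℕ.≟ 0))

  allFlows nzFlows : List (Edge d) → Demand → ℚ
  allFlows = flows (const 1ℚ)
  nzFlows  = flows nonzero

  flows-cong : ∀ wt A {b c} → b ≗ c → flows wt A b ≡ flows wt A c
  flows-cong wt []      {b} {c} b≗c = 𝟙-cong (mk⇔ (λ bal w → subst k∣_ (b≗c w) (bal w))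
                                           (λ bal w → subst k∣_ (sym (b≗c w)) (bal w))) (balanced? b) (balanced? c)
  flows-cong wt (e ∷ A) b≗c = ∑-cong (allFin k) (λ a →
    cong (wt a *_) (flows-cong wt A (λ w → cong (ℤ._- _) (b≗c w))))

  allFlows-cons : ∀ e A b → allFlows (e ∷ A) b ≡ ∑[ a ∈ allFin k ] allFlows A (residual b e a)
  allFlows-cons e A b = ∑-cong (allFin k) (λ a → ℚP.*-identityˡ (allFlows A (residual b e a)))

  residual-zero : ∀ b e → residual b e zero ≗ b
  residual-zero b (x , y) w = vanish (b w) (δ x w ℤ.- δ y w)
    where
    vanish : ∀ b z → b ℤ.- + 0 ℤ.* z ≡ b
    vanish = solve-∀

  residual-loop : ∀ b x a → residual b (x , x) a ≗ b
  residual-loop b x a w = cancel (b w) (+ toℕ a) (δ x w)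
    where
    cancel : ∀ b a z → b ℤ.- a ℤ.* (z ℤ.- z) ≡ b
    cancel = solve-∀

  residual-comm : ∀ b e a e′ a′ → residual (residual b e a) e′ a′ ≗ residual (residual b e′ a′) e a
  residual-comm b (x , y) a (x′ , y′) a′ w = swap (b w) _ _
    where
    swap : ∀ b p q → (b ℤ.- p) ℤ.- q ≡ (b ℤ.- q) ℤ.- p
    swap = solve-∀

  allFlows-loop : ∀ x A b → allFlows ((x , x) ∷ A) b ≡ K * allFlows A b
  allFlows-loop x A b = begin
    allFlows ((x , x) ∷ A) b                          ≡⟨ allFlows-cons (x , x) A b ⟩
    ∑[ a ∈ allFin k ] allFlows A (residual b (x , x) a) ≡⟨ ∑-cong (allFin k) (λ a → flows-cong _ A (residual-loop b x a)) ⟩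
    ∑[ a ∈ allFin k ] allFlows A b                    ≡⟨ ∑-const k _ ⟩
    K * allFlows A b                                  ∎
    where open ≡-Reasoning

  -- Contracting a non-loop edge u → v: the demands of u and v are merged at u.
  module FlowContraction (u v : Fin d) (u≢v : u ≢ v) where

    open Identify u v

    data Position (w : Fin d) : Set where
      at-v      : w ≡ v → Position w
      at-u      : w ≡ u → Position w
      elsewhere : w ≢ v → w ≢ u → Position w

    position : ∀ w → Position w
    position w with w FinP.≟ v | w FinP.≟ u
    ... | yes w≡v | _       = at-v w≡v
    ... | no _    | yes w≡u = at-u w≡u
    ... | no w≢v  | no w≢u  = elsewhere w≢v w≢u

    by-position : (P : Fin d → Set) → P v → P u → (∀ {w} → w ≢ v → w ≢ u → P w) → ∀ w → P w
    by-position P pv pu pw w with position w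
    ... | at-v refl         = pv
    ... | at-u refl         = pu
    ... | elsewhere w≢v w≢u = pw w≢v w≢u

    merge : Demand → Demand
    merge b w with position w
    ... | at-v _        = + 0
    ... | at-u _        = b u ℤ.+ b v
    ... | elsewhere _ _ = b w

    merge-v : ∀ b → merge b v ≡ + 0
    merge-v b with position v
    ... | at-v _          = refl
    ... | at-u v≡u        = ⊥-elim (u≢v (sym v≡u))
    ... | elsewhere v≢v _ = ⊥-elim (v≢v refl)

    merge-u : ∀ b → merge b u ≡ b u ℤ.+ b v
    merge-u b with position u
    ... | at-v u≡v        = ⊥-elim (u≢v u≡v)
    ... | at-u _          = refl
    ... | elsewhere _ u≢u = ⊥-elim (u≢u refl)

    merge-elsewhere : ∀ b {w} → w ≢ v → w ≢ u → merge b w ≡ b w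
    merge-elsewhere b {w} w≢v w≢u with position w
    ... | at-v w≡v        = ⊥-elim (w≢v w≡v)
    ... | at-u w≡u        = ⊥-elim (w≢u w≡u)
    ... | elsewhere _ _   = refl

    ρ-≢v : ∀ x → ρ x ≢ v
    ρ-≢v x with ρ-view x
    ... | inj₁ (_ , ρx≡u)   = λ ρx≡v → u≢v (trans (sym ρx≡u) ρx≡v)
    ... | inj₂ (x≢v , ρx≡x) = λ ρx≡v → x≢v (trans (sym ρx≡x) ρx≡v)

    δρ-v : ∀ x → δ (ρ x) v ≡ + 0
    δρ-v x = δ-diff (ρ-≢v x)

    δρ-u : ∀ x → δ (ρ x) u ≡ δ x u ℤ.+ δ x v
    δρ-u x with ρ-view x
    ... | inj₁ (refl , ρv≡u) = begin
      δ (ρ v) u          ≡⟨ cong (λ z → δ z u) ρv≡u ⟩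
      δ u u              ≡⟨ δ-same u ⟩
      + 0 ℤ.+ + 1        ≡⟨ cong₂ ℤ._+_ (sym (δ-diff (u≢v ∘ sym))) (sym (δ-same v)) ⟩
      δ v u ℤ.+ δ v v    ∎
      where open ≡-Reasoning
    ... | inj₂ (x≢v , ρx≡x) = begin
      δ (ρ x) u          ≡⟨ cong (λ z → δ z u) ρx≡x ⟩
      δ x u              ≡⟨ sym (ℤP.+-identityʳ (δ x u)) ⟩
      δ x u ℤ.+ + 0      ≡⟨ cong (ℤ._+_ (δ x u)) (sym (δ-diff x≢v)) ⟩
      δ x u ℤ.+ δ x v    ∎
      where open ≡-Reasoning

    δρ-elsewhere : ∀ x {w} → w ≢ v → w ≢ u → δ (ρ x) w ≡ δ x w
    δρ-elsewhere x {w} w≢v w≢u with ρ-view x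
    ... | inj₁ (refl , ρv≡u) = trans (cong (λ z → δ z w) ρv≡u) (trans (δ-diff (w≢u ∘ sym)) (sym (δ-diff (w≢v ∘ sym))))
    ... | inj₂ (_ , ρx≡x)    = cong (λ z → δ z w) ρx≡x

    merge-residual : ∀ b e a → merge (residual b e a) ≗ residual (merge b) (ρe e) a
    merge-residual b (x , y) a = by-position (λ w → merge (residual b (x , y) a) w ≡ residual (merge b) (ρe (x , y)) a w)
                                   case-v case-u case-elsewhere
      where
      open ≡-Reasoning
      vanish : ∀ a → + 0 ≡ + 0 ℤ.- a ℤ.* (+ 0 ℤ.- + 0)
      vanish = solve-∀
      collect : ∀ bu bv a xu yu xv yv →
                (bu ℤ.- a ℤ.* (xu ℤ.- yu)) ℤ.+ (bv ℤ.- a ℤ.* (xv ℤ.- yv)) ≡ (bu ℤ.+ bv) ℤ.- a ℤ.* ((xu ℤ.+ xv) ℤ.- (yu ℤ.+ yv))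
      collect = solve-∀
      case-v : merge (residual b (x , y) a) v ≡ residual (merge b) (ρe (x , y)) a v
      case-v = begin
        merge (residual b (x , y) a) v                          ≡⟨ merge-v _ ⟩
        + 0                                                     ≡⟨ vanish (+ toℕ a) ⟩
        + 0 ℤ.- + toℕ a ℤ.* (+ 0 ℤ.- + 0)
          ≡⟨ cong₂ (λ p q → p ℤ.- + toℕ a ℤ.* q) (sym (merge-v b)) (sym (cong₂ ℤ._-_ (δρ-v x) (δρ-v y))) ⟩
        residual (merge b) (ρe (x , y)) a v                     ∎
      case-u : merge (residual b (x , y) a) u ≡ residual (merge b) (ρe (x , y)) a u
      case-u = begin
        merge (residual b (x , y) a) u                          ≡⟨ merge-u _ ⟩
        residual b (x , y) a u ℤ.+ residual b (x , y) a v        ≡⟨ collect (b u) (b v) (+ toℕ a) (δ x u) (δ y u) (δ x v) (δ y v) ⟩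
        (b u ℤ.+ b v) ℤ.- + toℕ a ℤ.* ((δ x u ℤ.+ δ x v) ℤ.- (δ y u ℤ.+ δ y v))
          ≡⟨ cong₂ (λ p q → p ℤ.- + toℕ a ℤ.* q) (sym (merge-u b)) (sym (cong₂ ℤ._-_ (δρ-u x) (δρ-u y))) ⟩
        residual (merge b) (ρe (x , y)) a u                     ∎
      case-elsewhere : ∀ {w} → w ≢ v → w ≢ u → merge (residual b (x , y) a) w ≡ residual (merge b) (ρe (x , y)) a w
      case-elsewhere {w} w≢v w≢u = begin
        merge (residual b (x , y) a) w                          ≡⟨ merge-elsewhere _ w≢v w≢u ⟩
        b w ℤ.- + toℕ a ℤ.* (δ x w ℤ.- δ y w)
          ≡⟨ cong₂ (λ p q → p ℤ.- + toℕ a ℤ.* q) (sym (merge-elsewhere b w≢v w≢u))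
                   (sym (cong₂ ℤ._-_ (δρ-elsewhere x w≢v w≢u) (δρ-elsewhere y w≢v w≢u))) ⟩
        residual (merge b) (ρe (x , y)) a w                     ∎

    residual-v : ∀ b a → residual b (u , v) a v ≡ b v ℤ.+ + toℕ a
    residual-v b a = trans (cong₂ (λ p q → b v ℤ.- + toℕ a ℤ.* (p ℤ.- q)) (δ-diff u≢v) (δ-same v)) (flip (b v) (+ toℕ a))
      where
      flip : ∀ b a → b ℤ.- a ℤ.* (+ 0 ℤ.- + 1) ≡ b ℤ.+ a
      flip = solve-∀

    residual-u : ∀ b a → residual b (u , v) a u ≡ b u ℤ.- + toℕ a
    residual-u b a = trans (cong₂ (λ p q → b u ℤ.- + toℕ a ℤ.* (p ℤ.- q)) (δ-same u) (δ-diff (u≢v ∘ sym))) (unit (b u) (+ toℕ a))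
      where
      unit : ∀ b a → b ℤ.- a ℤ.* (+ 1 ℤ.- + 0) ≡ b ℤ.- a
      unit = solve-∀

    residual-elsewhere : ∀ b a {w} → w ≢ v → w ≢ u → residual b (u , v) a w ≡ b w
    residual-elsewhere b a {w} w≢v w≢u =
      trans (cong₂ (λ p q → b w ℤ.- + toℕ a ℤ.* (p ℤ.- q)) (δ-diff (w≢u ∘ sym)) (δ-diff (w≢v ∘ sym))) (residual-zero′ (b w) (+ toℕ a))
      where
      residual-zero′ : ∀ b a → b ℤ.- a ℤ.* (+ 0 ℤ.- + 0) ≡ b
      residual-zero′ = solve-∀

    balanced-split : ∀ b a → Balanced (residual b (u , v) a) ⇔ (Balanced (merge b) × k∣ (b v ℤ.+ + toℕ a))
    balanced-split b a = mk⇔ to from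
      where
      cancel⁺ : ∀ bu bv a → (bu ℤ.- a) ℤ.+ (bv ℤ.+ a) ≡ bu ℤ.+ bv
      cancel⁺ = solve-∀
      cancel⁻ : ∀ bu bv a → (bu ℤ.+ bv) ℤ.- (bv ℤ.+ a) ≡ bu ℤ.- a
      cancel⁻ = solve-∀
      res-u+res-v : residual b (u , v) a u ℤ.+ residual b (u , v) a v ≡ merge b u
      res-u+res-v = trans (cong₂ ℤ._+_ (residual-u b a) (residual-v b a))
                          (trans (cancel⁺ (b u) (b v) (+ toℕ a)) (sym (merge-u b)))
      merge-u-res-v : merge b u ℤ.- (b v ℤ.+ + toℕ a) ≡ residual b (u , v) a u
      merge-u-res-v = trans (cong (ℤ._- (b v ℤ.+ + toℕ a)) (merge-u b))
                            (trans (cancel⁻ (b u) (b v) (+ toℕ a)) (sym (residual-u b a)))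
      to : Balanced (residual b (u , v) a) → Balanced (merge b) × k∣ (b v ℤ.+ + toℕ a)
      to bal = by-position (k∣_ ∘ merge b)
                 (subst k∣_ (sym (merge-v b)) k∣-zero)
                 (subst k∣_ res-u+res-v (∣m∣n⇒∣m+n (bal u) (bal v)))
                 (λ {w} w≢v w≢u → subst k∣_ (trans (residual-elsewhere b a w≢v w≢u) (sym (merge-elsewhere b w≢v w≢u))) (bal w))
               , subst k∣_ (residual-v b a) (bal v)
      from : Balanced (merge b) × k∣ (b v ℤ.+ + toℕ a) → Balanced (residual b (u , v) a)
      from (bal , k∣bv+a) = by-position (k∣_ ∘ residual b (u , v) a)
        (subst k∣_ (sym (residual-v b a)) k∣bv+a)
        (subst k∣_ merge-u-res-v (∣m∣n⇒∣m-n (bal u) k∣bv+a))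
        (λ {w} w≢v w≢u → subst k∣_ (trans (merge-elsewhere b w≢v w≢u) (sym (residual-elsewhere b a w≢v w≢u))) (bal w))

    -- Contraction: on (u → v) ∷ A the value on u → v is forced by the demand at
    -- v, and what remains are the flows on the contracted edges with merged demand.
    allFlows-contract : ∀ A b → allFlows ((u , v) ∷ A) b ≡ allFlows (map ρe A) (merge b)
    allFlows-contract [] b = begin
      allFlows ((u , v) ∷ []) b
        ≡⟨ allFlows-cons (u , v) [] b ⟩
      ∑[ a ∈ allFin k ] 𝟙 (balanced? (residual b (u , v) a))
        ≡⟨ ∑-cong (allFin k) split ⟩
      ∑[ a ∈ allFin k ] (𝟙 (balanced? (merge b)) * 𝟙 (k∣? (b v ℤ.+ + toℕ a)))
        ≡⟨ sym (∑-*ˡ (allFin k) (𝟙 (balanced? (merge b))) (λ a → 𝟙 (k∣? (b v ℤ.+ + toℕ a)))) ⟩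
      𝟙 (balanced? (merge b)) * ∑[ a ∈ allFin k ] 𝟙 (k∣? (b v ℤ.+ + toℕ a))
        ≡⟨ cong (𝟙 (balanced? (merge b)) *_) (∑-residue (b v)) ⟩
      𝟙 (balanced? (merge b)) * 1ℚ
        ≡⟨ ℚP.*-identityʳ _ ⟩
      allFlows [] (merge b) ∎
      where
      open ≡-Reasoning
      split : ∀ a → 𝟙 (balanced? (residual b (u , v) a)) ≡ 𝟙 (balanced? (merge b)) * 𝟙 (k∣? (b v ℤ.+ + toℕ a))
      split a = trans (𝟙-cong (balanced-split b a) (balanced? (residual b (u , v) a)) (balanced? (merge b) ×-dec k∣? (b v ℤ.+ + toℕ a)))
                      (𝟙-× (balanced? (merge b)) (k∣? (b v ℤ.+ + toℕ a)) (balanced? (merge b) ×-dec k∣? (b v ℤ.+ + toℕ a)))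
    allFlows-contract (e ∷ A) b = begin
      allFlows ((u , v) ∷ e ∷ A) b
        ≡⟨ allFlows-cons (u , v) (e ∷ A) b ⟩
      ∑[ a ∈ allFin k ] allFlows (e ∷ A) (residual b (u , v) a)
        ≡⟨ ∑-cong (allFin k) (λ a → allFlows-cons e A (residual b (u , v) a)) ⟩
      ∑[ a ∈ allFin k ] ∑[ c ∈ allFin k ] allFlows A (residual (residual b (u , v) a) e c)
        ≡⟨ ∑-swap (allFin k) (allFin k) (λ a c → allFlows A (residual (residual b (u , v) a) e c)) ⟩
      ∑[ c ∈ allFin k ] ∑[ a ∈ allFin k ] allFlows A (residual (residual b (u , v) a) e c)
        ≡⟨ ∑-cong (allFin k) (λ c → ∑-cong (allFin k) (λ a → flows-cong _ A (residual-comm b (u , v) a e c))) ⟩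
      ∑[ c ∈ allFin k ] ∑[ a ∈ allFin k ] allFlows A (residual (residual b e c) (u , v) a)
        ≡⟨ ∑-cong (allFin k) (λ c → trans (sym (allFlows-cons (u , v) A (residual b e c))) (allFlows-contract A (residual b e c))) ⟩
      ∑[ c ∈ allFin k ] allFlows (map ρe A) (merge (residual b e c))
        ≡⟨ ∑-cong (allFin k) (λ c → flows-cong _ (map ρe A) (merge-residual b e c)) ⟩
      ∑[ c ∈ allFin k ] allFlows (map ρe A) (residual (merge b) (ρe e) c)
        ≡⟨ sym (allFlows-cons (ρe e) (map ρe A) (merge b)) ⟩
      allFlows (map ρe (e ∷ A)) (merge b) ∎
      where open ≡-Reasoning

-- Duality between colourings constant along edges and ℤ/k-flows:
--   k^|A| · #{s constant along A} = k^d · #{ℤ/k-flows on A},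
-- both sides being k^(|A| + number of components of A).
module Duality (k′ d : ℕ) where

  open Modulus k′
  open Colorings k′
  open Monochromatic k′ d
  open Flows k′ d

  private
    merge-noDemand : ∀ {u v} (u≢v : u ≢ v) → FlowContraction.merge u v u≢v noDemand ≗ noDemand
    merge-noDemand {u} {v} u≢v = by-position (λ w → merge noDemand w ≡ + 0) (merge-v noDemand)
                                   (merge-u noDemand) (merge-elsewhere noDemand)
      where open FlowContraction u v u≢v

    regroup : ∀ K p q → K * p * q ≡ p * (K * q)
    regroup = solve 3 (λ K p q → K :* p :* q := p :* (K :* q)) refl

    swap : ∀ K p q → K * (p * q) ≡ p * (K * q)
    swap = solve 3 (λ K p q → K :* (p :* q) := p :* (K :* q)) refl

  duality : ∀ A → K ^ℚ length A * monoCount A ≡ K ^ℚ d * allFlows A noDemand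
  duality A = induct (length A) A refl
    where
    induct : ∀ m A → length A ≡ m → K ^ℚ length A * monoCount A ≡ K ^ℚ d * allFlows A noDemand
    induct _ [] _ = begin
      1ℚ * ∑[ s ∈ colorings d ] 1ℚ  ≡⟨ ℚP.*-identityˡ _ ⟩
      ∑[ s ∈ colorings d ] 1ℚ       ≡⟨ ∑-colorings-1 d ⟩
      K ^ℚ d                        ≡⟨ sym (ℚP.*-identityʳ (K ^ℚ d)) ⟩
      K ^ℚ d * 1ℚ                   ≡⟨ cong (K ^ℚ d *_) (sym (𝟙-yes (λ _ → k∣-zero) (balanced? noDemand))) ⟩
      K ^ℚ d * allFlows [] noDemand ∎
      where open ≡-Reasoning
    induct (suc m) ((x , y) ∷ A) len with x FinP.≟ y
    ... | yes refl = begin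
      K * K ^ℚ length A * monoCount ((x , x) ∷ A)    ≡⟨ regroup K (K ^ℚ length A) _ ⟩
      K ^ℚ length A * (K * monoCount ((x , x) ∷ A))  ≡⟨ cong (λ c → K ^ℚ length A * (K * c)) (monoCount-loop x A) ⟩
      K ^ℚ length A * (K * monoCount A)              ≡⟨ sym (swap K (K ^ℚ length A) (monoCount A)) ⟩
      K * (K ^ℚ length A * monoCount A)              ≡⟨ cong (K *_) (induct m A (ℕP.suc-injective len)) ⟩
      K * (K ^ℚ d * allFlows A noDemand)             ≡⟨ swap K (K ^ℚ d) (allFlows A noDemand) ⟩
      K ^ℚ d * (K * allFlows A noDemand)             ≡⟨ cong (K ^ℚ d *_) (sym (allFlows-loop x A noDemand)) ⟩
      K ^ℚ d * allFlows ((x , x) ∷ A) noDemand       ∎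
      where open ≡-Reasoning
    ... | no x≢y = begin
      K * K ^ℚ length A * monoCount ((x , y) ∷ A)      ≡⟨ regroup K (K ^ℚ length A) _ ⟩
      K ^ℚ length A * (K * monoCount ((x , y) ∷ A))    ≡⟨ cong (K ^ℚ length A *_) (sym (monoCount-contract A)) ⟩
      K ^ℚ length A * monoCount (map ρe A)              ≡⟨ cong (λ n → K ^ℚ n * monoCount (map ρe A)) (sym (ListP.length-map ρe A)) ⟩
      K ^ℚ length (map ρe A) * monoCount (map ρe A)     ≡⟨ induct m (map ρe A) (trans (ListP.length-map ρe A) (ℕP.suc-injective len)) ⟩
      K ^ℚ d * allFlows (map ρe A) noDemand             ≡⟨ cong (K ^ℚ d *_) (flows-cong _ (map ρe A) (sym ∘ merge-noDemand x≢y)) ⟩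
      K ^ℚ d * allFlows (map ρe A) (merge noDemand)     ≡⟨ cong (K ^ℚ d *_) (sym (allFlows-contract A noDemand)) ⟩
      K ^ℚ d * allFlows ((x , y) ∷ A) noDemand          ∎
      where
      open ≡-Reasoning
      open Identify x y
      open MonoContraction x y x≢y
      open FlowContraction x y x≢y

-- All flows versus nowhere-zero flows: every flow is a nowhere-zero flow on
-- its support, which turns into the following identity of subset sums.
module NowhereZero (k′ d : ℕ) where

  open Modulus k′
  open Flows k′ d

  ∑⊆-flows-cons : ∀ α β wt e E b →
    ∑⊆[ α , β ] E (λ B → flows wt (e ∷ B) b) ≡ ∑[ a ∈ allFin k ] (wt a * ∑⊆[ α , β ] E (λ B → flows wt B (residual b e a)))
  ∑⊆-flows-cons α β wt e E b =
    trans (∑⊆-∑ α β E (allFin k) (λ a B → wt a * flows wt B (residual b e a)))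
          (∑-cong (allFin k) (λ a → ∑⊆-*ˡ α β E (wt a) (λ B → flows wt B (residual b e a))))

  nonzero-zero : nonzero zero ≡ 0ℚ
  nonzero-zero = 𝟙-no (λ 0≢0 → 0≢0 refl) (¬? (toℕ (zero {k′}) ℕ.≟ 0))

  allFlows-nzFlows : ∀ E b → ∑⊆[ - 1ℚ , K ] E (λ A → allFlows A b) ≡ ∑⊆[ - 1ℚ , K - 1ℚ ] E (λ A → nzFlows A b)
  allFlows-nzFlows []      b = refl
  allFlows-nzFlows (e ∷ E) b = begin
    - 1ℚ * ∑⊆[ - 1ℚ , K ] E (λ B → allFlows (e ∷ B) b) + K * Q b
      ≡⟨ cong (λ x → - 1ℚ * x + K * Q b) (∑⊆-flows-cons (- 1ℚ) K (λ _ → 1ℚ) e E b) ⟩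
    - 1ℚ * ∑[ a ∈ allFin k ] (1ℚ * Q (residual b e a)) + K * Q b
      ≡⟨ cong₂ (λ x y → - 1ℚ * x + K * y) (∑-cong (allFin k) (λ a → cong (1ℚ *_) (allFlows-nzFlows E (residual b e a)))) (allFlows-nzFlows E b) ⟩
    - 1ℚ * ∑[ a ∈ allFin k ] (1ℚ * R (residual b e a)) + K * R b
      ≡⟨ cong (λ x → - 1ℚ * x + K * R b) (∑-allFin-suc k′ (λ a → 1ℚ * R (residual b e a))) ⟩
    - 1ℚ * (1ℚ * R (residual b e zero) + Z) + K * R b
      ≡⟨ cong (λ x → - 1ℚ * (1ℚ * x + Z) + K * R b) R-zero ⟩
    - 1ℚ * (1ℚ * R b + Z) + K * R b
      ≡⟨ solve 3 (λ K r y → con (- 1ℚ) :* (con 1ℚ :* r :+ y) :+ K :* r := con (- 1ℚ) :* (con 0ℚ :* r :+ y) :+ (K :- con 1ℚ) :* r) refl K (R b) Z ⟩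
    - 1ℚ * (0ℚ * R b + Z) + (K - 1ℚ) * R b
      ≡⟨ cong₂ (λ x y → - 1ℚ * (x * y + Z) + (K - 1ℚ) * R b) (sym nonzero-zero) (sym R-zero) ⟩
    - 1ℚ * (nonzero zero * R (residual b e zero) + Z) + (K - 1ℚ) * R b
      ≡⟨ cong (λ x → - 1ℚ * x + (K - 1ℚ) * R b) (sym (∑-allFin-suc k′ (λ a → nonzero a * R (residual b e a)))) ⟩
    - 1ℚ * ∑[ a ∈ allFin k ] (nonzero a * R (residual b e a)) + (K - 1ℚ) * R b
      ≡⟨ cong (λ x → - 1ℚ * x + (K - 1ℚ) * R b) (sym (∑⊆-flows-cons (- 1ℚ) (K - 1ℚ) nonzero e E b)) ⟩
    - 1ℚ * ∑⊆[ - 1ℚ , K - 1ℚ ] E (λ B → nzFlows (e ∷ B) b) + (K - 1ℚ) * R b ∎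
    where
    open ≡-Reasoning
    Q R : Demand → ℚ
    Q c = ∑⊆[ - 1ℚ , K ] E (λ A → allFlows A c)
    R c = ∑⊆[ - 1ℚ , K - 1ℚ ] E (λ A → nzFlows A c)
    R-zero : R (residual b e zero) ≡ R b
    R-zero = ∑⊆-cong (- 1ℚ) (K - 1ℚ) E (λ A → flows-cong nonzero A (residual-zero b e))
    -- the nonzero values; there both weights are 1
    Z : ℚ
    Z = ∑[ a ∈ allFin k′ ] (nonzero (suc a) * R (residual b e (suc a)))

module ChromaticSum (k′ : ℕ) (G : Graph) where

  open Modulus k′
  open Colorings k′
  open Monochromatic k′ (n G)

  chromatic-∑∏ : ℕ→ℚ (chromatic G k) ≡ ∑[ s ∈ colorings (n G) ] ∏[ e ∈ edges G ] (1ℚ - same (s (proj₁ e)) (s (proj₂ e)))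
  chromatic-∑∏ = trans (count-∑ (proper? G k) (colorings (n G))) (∑-cong (colorings (n G)) λ s →
    trans (𝟙-all _ (edges G)) (∏-cong (edges G) (λ e → 𝟙-¬ (s (proj₁ e) FinP.≟ s (proj₂ e)))))

module FlowSum (k′ d : ℕ) where

  open Modulus k′
  open Colorings k′
  open Flows k′ d

  netFlow : (A : List (Edge d)) → Coloring (length A) → Fin d → ℤ.ℤ
  netFlow A t w = + endSum A proj₁ t w ℤ.- + endSum A proj₂ t w

  NZFlow : (A : List (Edge d)) → Demand → Coloring (length A) → Set
  NZFlow A b t = (∀ i → toℕ (t i) ≢ 0) × (∀ w → k∣ (netFlow A t w ℤ.- b w))

  nzFlow? : ∀ A b t → Dec (NZFlow A b t)
  nzFlow? A b t = FinP.all? (λ i → ¬? (toℕ (t i) ℕ.≟ 0)) ×-dec FinP.all? (λ w → k∣? (netFlow A t w ℤ.- b w))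

  endSum-cons : ∀ (e : Edge d) A (end : Edge d → Fin d) (a : Fin k) (t : Coloring (length A)) w →
    endSum (e ∷ A) end (a ◂ t) w ≡ (if ⌊ end e FinP.≟ w ⌋ then toℕ a else 0) ℕ.+ endSum A end t w
  endSum-cons e A end a t w = cong (term zero ℕ.+_) (cong (foldr ℕ._+_ 0)
    (trans (ListP.map-tabulate suc term) (sym (ListP.map-tabulate id (term ∘ suc)))))
    where
    term : Fin (suc (length A)) → ℕ
    term i = if ⌊ end (lookup (e ∷ A) i) FinP.≟ w ⌋ then toℕ ((a ◂ t) i) else 0

  if-δ : ∀ x w m → + (if ⌊ x FinP.≟ w ⌋ then m else 0) ≡ + m ℤ.* δ x w
  if-δ x w m with x FinP.≟ w
  ... | yes _ = sym (ℤP.*-identityʳ (+ m))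
  ... | no _  = sym (ℤP.*-zeroʳ (+ m))

  -- the value a on x → y moves into the demand
  netFlow-cons : ∀ x y A b a t w →
    netFlow ((x , y) ∷ A) (a ◂ t) w ℤ.- b w ≡ netFlow A t w ℤ.- residual b (x , y) a w
  netFlow-cons x y A b a t w = begin
    netFlow ((x , y) ∷ A) (a ◂ t) w ℤ.- b w
      ≡⟨ cong₂ (λ p q → p ℤ.- q ℤ.- b w) (end-cons proj₁) (end-cons proj₂) ⟩
    (+ toℕ a ℤ.* δ x w ℤ.+ + endSum A proj₁ t w) ℤ.- (+ toℕ a ℤ.* δ y w ℤ.+ + endSum A proj₂ t w) ℤ.- b w
      ≡⟨ move (+ toℕ a) (δ x w) (δ y w) (+ endSum A proj₁ t w) (+ endSum A proj₂ t w) (b w) ⟩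
    netFlow A t w ℤ.- residual b (x , y) a w ∎
    where
    open ≡-Reasoning
    move : ∀ a dx dy o i b → (a ℤ.* dx ℤ.+ o) ℤ.- (a ℤ.* dy ℤ.+ i) ℤ.- b ≡ o ℤ.- i ℤ.- (b ℤ.- a ℤ.* (dx ℤ.- dy))
    move = solve-∀
    end-cons : ∀ (end : Edge d → Fin d) →
               + endSum ((x , y) ∷ A) end (a ◂ t) w ≡ + toℕ a ℤ.* δ (end (x , y)) w ℤ.+ + endSum A end t w
    end-cons end = begin
      + endSum ((x , y) ∷ A) end (a ◂ t) w                              ≡⟨ cong +_ (endSum-cons (x , y) A end a t w) ⟩
      + ((if ⌊ end (x , y) FinP.≟ w ⌋ then toℕ a else 0) ℕ.+ endSum A end t w)
        ≡⟨ ℤP.pos-+ (if ⌊ end (x , y) FinP.≟ w ⌋ then toℕ a else 0) (endSum A end t w) ⟩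
      + (if ⌊ end (x , y) FinP.≟ w ⌋ then toℕ a else 0) ℤ.+ + endSum A end t w
        ≡⟨ cong (ℤ._+ + endSum A end t w) (if-δ (end (x , y)) w (toℕ a)) ⟩
      + toℕ a ℤ.* δ (end (x , y)) w ℤ.+ + endSum A end t w                ∎

  nzFlow-cons : ∀ x y A b a t →
    NZFlow ((x , y) ∷ A) b (a ◂ t) ⇔ (toℕ a ≢ 0 × NZFlow A (residual b (x , y) a) t)
  nzFlow-cons x y A b a t = mk⇔
    (λ (nz , bal) → nz zero , (nz ∘ suc) , λ w → subst k∣_ (netFlow-cons x y A b a t w) (bal w))
    (λ (nz₀ , nz , bal) → (λ { zero → nz₀ ; (suc i) → nz i }) ,
                          λ w → subst k∣_ (sym (netFlow-cons x y A b a t w)) (bal w))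

  count-nzFlows : ∀ A b → ∑[ t ∈ colorings (length A) ] 𝟙 (nzFlow? A b t) ≡ nzFlows A b
  count-nzFlows [] b = trans (∑-cong (colorings 0) no-edges) (ℚP.+-identityʳ (𝟙 (balanced? b)))
    where
    no-edges : ∀ t → 𝟙 (nzFlow? [] b t) ≡ 𝟙 (balanced? b)
    no-edges t = 𝟙-cong (mk⇔ (λ (_ , bal) w → k∣-negate (subst k∣_ (no-flow w) (bal w)))
                             (λ bal → (λ ()) , λ w → subst k∣_ (sym (no-flow w)) (∣m⇒∣-m (bal w))))
                        (nzFlow? [] b t) (balanced? b)
      where
      no-flow : ∀ w → netFlow [] t w ℤ.- b w ≡ ℤ.- b w
      no-flow w = ℤP.+-identityˡ (ℤ.- b w)
  count-nzFlows ((x , y) ∷ A) b = begin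
    ∑[ t ∈ colorings (suc (length A)) ] 𝟙 (nzFlow? ((x , y) ∷ A) b t)
      ≡⟨ ∑-colorings-suc (length A) (λ t → 𝟙 (nzFlow? ((x , y) ∷ A) b t)) ⟩
    ∑[ a ∈ allFin k ] ∑[ t ∈ colorings (length A) ] 𝟙 (nzFlow? ((x , y) ∷ A) b (a ◂ t))
      ≡⟨ ∑-cong (allFin k) (λ a → ∑-cong (colorings (length A)) (λ t → split a t)) ⟩
    ∑[ a ∈ allFin k ] ∑[ t ∈ colorings (length A) ] (nonzero a * 𝟙 (nzFlow? A (residual b (x , y) a) t))
      ≡⟨ ∑-cong (allFin k) (λ a → sym (∑-*ˡ (colorings (length A)) (nonzero a) (λ t → 𝟙 (nzFlow? A (residual b (x , y) a) t)))) ⟩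
    ∑[ a ∈ allFin k ] (nonzero a * ∑[ t ∈ colorings (length A) ] 𝟙 (nzFlow? A (residual b (x , y) a) t))
      ≡⟨ ∑-cong (allFin k) (λ a → cong (nonzero a *_) (count-nzFlows A (residual b (x , y) a))) ⟩
    nzFlows ((x , y) ∷ A) b ∎
    where
    open ≡-Reasoning
    split : ∀ a t → 𝟙 (nzFlow? ((x , y) ∷ A) b (a ◂ t)) ≡ nonzero a * 𝟙 (nzFlow? A (residual b (x , y) a) t)
    split a t = trans (𝟙-cong (nzFlow-cons x y A b a t) (nzFlow? ((x , y) ∷ A) b (a ◂ t)) both?)
                      (𝟙-× (¬? (toℕ a ℕ.≟ 0)) (nzFlow? A (residual b (x , y) a) t) both?)
      where
      both? : Dec (toℕ a ≢ 0 × NZFlow A (residual b (x , y) a) t)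
      both? = ¬? (toℕ a ℕ.≟ 0) ×-dec nzFlow? A (residual b (x , y) a) t

  -- Defs.IsNZFlow is NZFlow with no demand, with lists of conditions and unsigned divisibility
  flow-nzFlows : ∀ A → ℕ→ℚ (flow (record { n = d ; edges = A }) k) ≡ nzFlows A noDemand
  flow-nzFlows A = begin
    ℕ→ℚ (flow H k)                                           ≡⟨ count-∑ (isNZFlow? H k) (colorings (length A)) ⟩
    ∑[ t ∈ colorings (length A) ] 𝟙 (isNZFlow? H k t)
      ≡⟨ ∑-cong (colorings (length A)) (λ t → 𝟙-cong (same-condition t) (isNZFlow? H k t) (nzFlow? A noDemand t)) ⟩
    ∑[ t ∈ colorings (length A) ] 𝟙 (nzFlow? A noDemand t)   ≡⟨ count-nzFlows A noDemand ⟩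
    nzFlows A noDemand                                       ∎
    where
    open ≡-Reasoning
    H : Graph
    H = record { n = d ; edges = A }
    same-condition : ∀ t → IsNZFlow H k t ⇔ NZFlow A noDemand t
    same-condition t = mk⇔
      (λ (nz , bal) → AllP.tabulate⁻ nz , λ w → subst k∣_ (sym (ℤP.+-identityʳ (netFlow A t w))) (∣ᵤ⇒∣ (AllP.tabulate⁻ bal w)))
      (λ (nz , bal) → AllP.tabulate⁺ nz , AllP.tabulate⁺ (λ w → ∣⇒∣ᵤ (subst k∣_ (ℤP.+-identityʳ (netFlow A t w)) (bal w))))

module ChromaticFlow (k″ : ℕ) (G : Graph) where

  k′ : ℕ
  k′ = suc k″

  open Modulus k′
  open Colorings k′
  open Monochromatic k′ (n G)
  open Flows k′ (n G)
  open Duality k′ (n G)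
  open NowhereZero k′ (n G)
  open ChromaticSum k′ G
  open FlowSum k′ (n G)

  E : List (Edge (n G))
  E = edges G

  graph : List (Edge (n G)) → Graph
  graph A = record { n = n G ; edges = A }

  -- Expanding ∏ₑ (1 - [s constant on e]) over subsets A of the edges.
  chromatic-expansion : K ^ℚ length E * ℕ→ℚ (chromatic G k) ≡ ∑⊆[ - 1ℚ , K ] E (λ A → K ^ℚ length A * monoCount A)
  chromatic-expansion = begin
    K ^ℚ length E * ℕ→ℚ (chromatic G k)
      ≡⟨ cong (K ^ℚ length E *_) chromatic-∑∏ ⟩
    K ^ℚ length E * ∑[ s ∈ colorings (n G) ] ∏[ e ∈ E ] (1ℚ - c s e)
      ≡⟨ ∑-*ˡ (colorings (n G)) (K ^ℚ length E) _ ⟩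
    ∑[ s ∈ colorings (n G) ] (K ^ℚ length E * ∏[ e ∈ E ] (1ℚ - c s e))
      ≡⟨ ∑-cong (colorings (n G)) (λ s → ∏-scale E K (λ e → 1ℚ - c s e)) ⟩
    ∑[ s ∈ colorings (n G) ] ∏[ e ∈ E ] (K * (1ℚ - c s e))
      ≡⟨ ∑-cong (colorings (n G)) (λ s → ∏-cong E (λ e → binomial (c s e))) ⟩
    ∑[ s ∈ colorings (n G) ] ∏[ e ∈ E ] ((K * - 1ℚ) * c s e + K)
      ≡⟨ ∑-cong (colorings (n G)) (λ s → sym (∑⊆-∏ (K * - 1ℚ) K E (c s))) ⟩
    ∑[ s ∈ colorings (n G) ] ∑⊆[ K * - 1ℚ , K ] E (λ A → mono A s)
      ≡⟨ sym (∑⊆-∑ (K * - 1ℚ) K E (colorings (n G)) (λ s A → mono A s)) ⟩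
    ∑⊆[ K * - 1ℚ , K ] E monoCount
      ≡⟨ ∑⊆-rescale K (- 1ℚ) K E monoCount ⟩
    ∑⊆[ - 1ℚ , K ] E (λ A → K ^ℚ length A * monoCount A) ∎
    where
    open ≡-Reasoning
    c : Coloring (n G) → Edge (n G) → ℚ
    c s e = same (s (proj₁ e)) (s (proj₂ e))
    binomial : ∀ x → K * (1ℚ - x) ≡ (K * - 1ℚ) * x + K
    binomial x = solve 2 (λ K x → K :* (con 1ℚ :- x) := (K :* con (- 1ℚ)) :* x :+ K) refl K x

  flow-expansion : ∑⊆[ - 1ℚ , K ] E (λ A → K ^ℚ length A * monoCount A) ≡
                   K ^ℚ n G * ((K - 1ℚ) ^ℚ length E * ∑[ A ∈ sublists E ] (ℕ→ℚ (flow (graph A) k) /ℚ ((1ℚ - K) ^ℚ length A)))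
  flow-expansion = begin
    ∑⊆[ - 1ℚ , K ] E (λ A → K ^ℚ length A * monoCount A)
      ≡⟨ ∑⊆-cong (- 1ℚ) K E duality ⟩
    ∑⊆[ - 1ℚ , K ] E (λ A → K ^ℚ n G * allFlows A noDemand)
      ≡⟨ ∑⊆-*ˡ (- 1ℚ) K E (K ^ℚ n G) (λ A → allFlows A noDemand) ⟩
    K ^ℚ n G * ∑⊆[ - 1ℚ , K ] E (λ A → allFlows A noDemand)
      ≡⟨ cong (K ^ℚ n G *_) (allFlows-nzFlows E noDemand) ⟩
    K ^ℚ n G * ∑⊆[ - 1ℚ , K - 1ℚ ] E (λ A → nzFlows A noDemand)
      ≡⟨ cong (K ^ℚ n G *_) (sym (∑⊆-sublists weights (1-ℕ→ℚ≢0 k″) E (λ A → nzFlows A noDemand))) ⟩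
    K ^ℚ n G * ((K - 1ℚ) ^ℚ length E * ∑[ A ∈ sublists E ] (nzFlows A noDemand /ℚ ((1ℚ - K) ^ℚ length A)))
      ≡⟨ cong (λ x → K ^ℚ n G * ((K - 1ℚ) ^ℚ length E * x)) (∑-cong (sublists E) (λ A → cong (_/ℚ ((1ℚ - K) ^ℚ length A)) (sym (flow-nzFlows A)))) ⟩
    K ^ℚ n G * ((K - 1ℚ) ^ℚ length E * ∑[ A ∈ sublists E ] (ℕ→ℚ (flow (graph A) k) /ℚ ((1ℚ - K) ^ℚ length A))) ∎
    where
    open ≡-Reasoning
    weights : - 1ℚ * (1ℚ - K) ≡ K - 1ℚ
    weights = solve 1 (λ K → con (- 1ℚ) :* (con 1ℚ :- K) := K :- con 1ℚ) refl K

  sum-edgeSubgraphs : ∀ (f : Graph → ℚ) → ∑[ A ∈ sublists E ] f (graph A) ≡ sumℚ (map f (edgeSubgraphs G))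
  sum-edgeSubgraphs f = sym (trans (sumℚ-map (edgeSubgraphs G) f) (∑-map (sublists E) graph f))

mainTheorem1 : (G : Graph) (k : ℕ) → 2 ≤ k →
    ℕ→ℚ (chromatic G k) ≡
      ((((ℕ→ℚ k - 1ℚ) ^ℚ mE G) * (ℕ→ℚ k ^ℚ nV G)) /ℚ (ℕ→ℚ k ^ℚ mE G))
      * sumℚ (map (λ H → ℕ→ℚ (flow H k) /ℚ ((1ℚ - ℕ→ℚ k) ^ℚ mE H)) (edgeSubgraphs G))
mainTheorem1 G (suc (suc k″)) (s≤s (s≤s _)) = solve-for (^-nonZero (mE G) (ℕ→ℚ-suc≢0 k′)) (begin
    K ^ℚ mE G * ℕ→ℚ (chromatic G k)
      ≡⟨ chromatic-expansion ⟩
    ∑⊆[ - 1ℚ , K ] E (λ A → K ^ℚ length A * monoCount A)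
      ≡⟨ flow-expansion ⟩
    K ^ℚ nV G * ((K - 1ℚ) ^ℚ mE G * S)
      ≡⟨ solve 3 (λ a b s → a :* (b :* s) := (b :* a) :* s) refl (K ^ℚ nV G) ((K - 1ℚ) ^ℚ mE G) S ⟩
    ((K - 1ℚ) ^ℚ mE G * K ^ℚ nV G) * S
      ≡⟨ cong (((K - 1ℚ) ^ℚ mE G * K ^ℚ nV G) *_) (sum-edgeSubgraphs (λ H → ℕ→ℚ (flow H k) /ℚ ((1ℚ - K) ^ℚ mE H))) ⟩
    ((K - 1ℚ) ^ℚ mE G * K ^ℚ nV G) * sumℚ (map (λ H → ℕ→ℚ (flow H k) /ℚ ((1ℚ - K) ^ℚ mE H)) (edgeSubgraphs G)) ∎)
  where
  open ChromaticFlow k″ G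
  open Modulus k′
  open Monochromatic k′ (n G)
  open ≡-Reasoning
  S : ℚ
  S = ∑[ A ∈ sublists E ] (ℕ→ℚ (flow (graph A) k) /ℚ ((1ℚ - K) ^ℚ length A))
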